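{- Let $H$ be a 3-uniform hypergraph on $n \geq 5$ vertices with $\delta_2^{\mathrm{ess}}(H) > 5n/6$, and let $O = (x_1,x_2,x_3)$ be an ordered triple of distinct vertices with $\{x_1,x_2,x_3\} \in E(H)$. Then $$w_H(O) = \frac16\Bigg( W(x_1,x_2) - \sum_{y \in \mathrm{CN}(x_1,x_2,x_3)} \bigg( W(x_1,y,x_2) - W(x_1,x_2,y) + \sum_{z \in \mathrm{CN}(x_1,x_2,x_3,y)} \big( W(x_1,y,x_2,z) - W(x_1,x_2,y,z) + W(x_1,y,z,x_2) - W(y,z,x_1,x_2)\big)\bigg)\Bigg).$$
   Context: For a pair $p$ of vertices of a 3-uniform hypergraph $H$, $N(p)=\{v: p\cup\{v\}\in E(H)\}$, $\deg(p)=|N(p)|$, and $\delta_2^{\mathrm{ess}}(H)=\min\{\deg(p):\deg(p)>0\}$. For a vertex set $S$, $\mathrm{CN}(S)=\bigcap_{p\subseteq S,|p|=2}N(p)$, written $\mathrm{CN}(x_1,\dots,x_k)$ for $S=\{x_1,\dots,x_k\}$. For $r\in\{3,4,5\}$ an $r$-clique is an $r$-set of vertices all of whose 3-subsets are edges; $\mathcal{K}_r(H,S)$ is the set of $r$-cliques containing $S$. For $r\in\{2,3,4\}$, $W(v_1,\dots,v_r)=\prod_{i=2}^{r}1/|\mathcal{K}_{i+1}(H,\{v_1,\dots,v_i\})|$. An ordered 5-clique is a 5-tuple $(v_1,\dots,v_5)$ of distinct vertices forming a 5-clique; $\mathcal{OK}_5(H,O)$ is the set of ordered 5-cliques in which $x_1,x_2,x_3$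 occur as a subsequence in this order. For an ordered 5-clique $K=(v_1,\dots,v_5)$ and $e\in E(H)$, $\psi_K(e)=1/3$ if $e\subseteq\{v_1,\dots,v_5\}$ and $|e\cap\{v_1,v_2\}|\in\{0,2\}$, $\psi_K(e)=-1/6$ if $e\subseteq\{v_1,\dots,v_5\}$ and $|e\cap\{v_1,v_2\}|=1$, and $0$ otherwise. Finally $w_H(O)=\frac12\sum_{K=(v_1,\dots,v_5)\in\mathcal{OK}_5(H,O)}W(v_1,\dots,v_4)\psi_K(\{x_1,x_2,x_3\})$. -}

module Defs where

open import Data.Nat using (ℕ; zero; suc; _+_; _*_; _∸_)
open import Data.Bool using (Bool; true; false; _∧_; _∨_; not; if_then_else_)
open import Data.Fin using (Fin; zero; suc; toℕ)
open import Data.Nat using (_<ᵇ_)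
open import Data.Bool.ListAction using (all; any)
open import Data.Fin.Subset using (Subset; ⁅_⁆; _∪_; ∣_∣)
open import Data.Vec using (Vec; []; _∷_; lookup)
open import Data.List using (List; []; _∷_; map; _++_; foldr; length; take; upTo; allFin)
open import Data.Integer using (+_)
open import Data.Rational using (ℚ; 0ℚ; 1ℚ; _/_) renaming (_+_ to _+ℚ_; _*_ to _*ℚ_)
open import Data.Nat using (_≡ᵇ_)
open import Data.Fin using () renaming (_≟_ to _≟ᶠ_)
open import Relation.Nullary using (does)
open import Relation.Binary.PropositionalEquality using (_≡_)

record Hypergraph3 (n : ℕ) : Set where
  field
    E       : Subset n → Bool
    uniform : ∀ s → E s ≡ true → ∣ s ∣ ≡ 3

open Hypergraph3 public

_∈ᵇ_ : ∀ {n} → Fin n → Subset n → Bool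
x ∈ᵇ s = lookup s x

_⊆ᵇ_ : ∀ {n} → Subset n → Subset n → Bool
[] ⊆ᵇ [] = true
(a ∷ s) ⊆ᵇ (b ∷ t) = (not a ∨ b) ∧ (s ⊆ᵇ t)

filterᵇ : ∀ {A : Set} → (A → Bool) → List A → List A
filterᵇ p [] = []
filterᵇ p (x ∷ xs) = if p x then x ∷ filterᵇ p xs else filterᵇ p xs

allSubsets : (n : ℕ) → List (Subset n)
allSubsets zero = [] ∷ []
allSubsets (suc n) = map (true ∷_) (allSubsets n) ++ map (false ∷_) (allSubsets n)

subsetsOfSize : ∀ {n} → ℕ → Subset n → List (Subset n)
subsetsOfSize {n} k s = filterᵇ (λ t → (∣ t ∣ ≡ᵇ k) ∧ (t ⊆ᵇ s)) (allSubsets n)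

setOf : ∀ {n} → List (Fin n) → Subset n
setOf [] = Data.Fin.Subset.⊥
setOf (x ∷ xs) = ⁅ x ⁆ ∪ setOf xs

countV : ∀ {n} → (Fin n → Bool) → ℕ
countV {n} P = length (filterᵇ P (allFin n))

sumℚ : List ℚ → ℚ
sumℚ = foldr _+ℚ_ 0ℚ

prodℚ : List ℚ → ℚ
prodℚ = foldr _*ℚ_ 1ℚ

ΣV : ∀ {n} → (Fin n → ℚ) → ℚ
ΣV {n} f = sumℚ (map f (allFin n))

ΣV[_]_ : ∀ {n} → (Fin n → Bool) → (Fin n → ℚ) → ℚ
ΣV[ P ] f = ΣV (λ v → if P v then f v else 0ℚ)

-- 1/k with the (never used) convention 1/0 = 0
inv : ℕ → ℚ
inv zero = 0ℚ
inv (suc k) = + 1 / suc k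

module _ {n : ℕ} (H : Hypergraph3 n) where

  Nb : Subset n → Fin n → Bool
  Nb p v = E H (p ∪ ⁅ v ⁆)

  deg : Subset n → ℕ
  deg p = countV (Nb p)

  CN : Subset n → Fin n → Bool
  CN S v = all (λ p → Nb p v) (subsetsOfSize 2 S)

  isClique : Subset n → Bool
  isClique T = all (E H) (subsetsOfSize 3 T)

  #K : ℕ → Subset n → ℕ
  #K r S = length (filterᵇ (λ T → isClique T ∧ (S ⊆ᵇ T)) (subsetsOfSize r Data.Fin.Subset.⊤))

  -- W(v₁,…,v_r) = ∏_{i=2}^{r} 1/|K_{i+1}(H,{v₁,…,v_i})|
  W : List (Fin n) → ℚ
  W vs = prodℚ (map (λ j → inv (#K (3 + j) (setOf (take (2 + j) vs)))) (upTo (length vs ∸ 1)))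

  distinctB : (Fin 5 → Fin n) → Bool
  distinctB v = all (λ i → all (λ j → does (i ≟ᶠ j) ∨ not (does (v i ≟ᶠ v j))) (allFin 5)) (allFin 5)

  vset5 : (Fin 5 → Fin n) → Subset n
  vset5 v = setOf (map v (allFin 5))

  isOrdered5Clique : (Fin 5 → Fin n) → Bool
  isOrdered5Clique v = distinctB v ∧ isClique (vset5 v)

  subseqB : Fin n → Fin n → Fin n → (Fin 5 → Fin n) → Bool
  subseqB x₁ x₂ x₃ v =
    any (λ i → any (λ j → any (λ k →
      (toℕ i <ᵇ toℕ j) ∧ (toℕ j <ᵇ toℕ k) ∧ does (v i ≟ᶠ x₁) ∧ does (v j ≟ᶠ x₂) ∧ does (v k ≟ᶠ x₃))
      (allFin 5)) (allFin 5)) (allFin 5)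

  ψ : (Fin 5 → Fin n) → Subset n → ℚ
  ψ v e with e ⊆ᵇ vset5 v
  ... | false = 0ℚ
  ... | true with (v zero ∈ᵇ e) | (v (suc zero) ∈ᵇ e)
  ...   | true  | true  = + 1 / 3
  ...   | false | false = + 1 / 3
  ...   | _     | _     = Data.Rational.-_ (+ 1 / 6)

  wH : Fin n → Fin n → Fin n → ℚ
  wH x₁ x₂ x₃ =
    (+ 1 / 2) *ℚ
    ΣV (λ a → ΣV (λ b → ΣV (λ c → ΣV (λ d → ΣV (λ e →
      let v = tup a b c d e in
      if isOrdered5Clique v ∧ subseqB x₁ x₂ x₃ v
        then W (v zero ∷ v (suc zero) ∷ v (suc (suc zero)) ∷ v (suc (suc (suc zero))) ∷ [])
               *ℚ ψ v (setOf (x₁ ∷ x₂ ∷ x₃ ∷ []))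
        else 0ℚ)))))
    where
      tup : Fin n → Fin n → Fin n → Fin n → Fin n → Fin 5 → Fin n
      tup a b c d e zero = a
      tup a b c d e (suc zero) = b
      tup a b c d e (suc (suc zero)) = c
      tup a b c d e (suc (suc (suc zero))) = d
      tup a b c d e (suc (suc (suc (suc zero)))) = e

{-# OPTIONS --safe #-}
module Submission where

-- Write X = {x₁, x₂, x₃}. An ordered 5-clique in which x₁, x₂, x₃ occur in this order is
-- determined by the positions of x₁, x₂, x₃ (one of ten patterns) and by the ordered pair (y, z)
-- of its remaining vertices; it is a clique exactly when y ∈ CN(X) and z ∈ CN(X ∪ {y}). Since
-- ψ_K(X) only depends on which of v₁, v₂ lie in X, each pattern contributes a constant times a
-- double sum of W(v₁, …, v₄) over such y, z. W(v₁, …, v₄) only depends on the sets {v₁, v₂},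
-- {v₁, v₂, v₃} and {v₁, …, v₄}. When z comes last, v₁, …, v₄ form the 4-clique X ∪ {y}, whose
-- extensions to 5-cliques are exactly the vertices of CN(X ∪ {y}); so summing over z cancels the
-- factor 1/|K₅(H, X ∪ {y})|, and in the same way summing over y cancels 1/|K₄(H, X)|. This needs
-- CN(X) and CN(X ∪ {y}) to be nonempty, which is where the codegree condition enters: each of
-- the at most six pairs of a 4-clique misses fewer than n/6 vertices.

open import Defs

open import Algebra.Bundles using (CommutativeMonoid; Ring)
open import Data.Bool using (Bool; true; false; _∧_; _∨_; not; if_then_else_)
open import Data.Bool.ListAction using (all; any; or)
open import Data.Bool.Properties using (T-≡; ⇔→≡; ∧-comm; ∧-zeroʳ; ∨-commutativeMonoid)
open import Data.Empty using (⊥-elim)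
open import Data.Fin as Fin using (Fin; zero; suc; punchIn)
open import Data.Fin.Patterns using (0F; 1F; 2F; 3F; 4F)
open import Data.Fin.Properties using (_≟_; punchIn-injective)
open import Data.Fin.Subset using (Subset; ⁅_⁆; _∪_; ∣_∣; ⊥; ⊤; _∈_; _∉_; _⊆_; _─_; inside; outside)
  renaming (_-_ to _∖_)
open import Data.Fin.Subset.Properties
  using (_∈?_; x∈p∪q⁺; x∈p∪q⁻; x∈⁅x⁆; x∈⁅y⁆⇒x≡y; ∉⊥; ⊆-antisym; ⊆-trans; drop-∷-⊆; ⊆⊤; p⊆p∪q;
         p─q⊆p; x∈p∧x≢y⇒x∈p-y; ∪-identityˡ; ∪-identityʳ; ∪-comm; ∪-assoc; ∪-idem;
         p⊆q⇒∣p∣≤∣q∣; ∣⁅x⁆∣≡1; ∣⊥∣≡0; ∣p∣≤n)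
open import Data.Integer using (+_)
import Data.Integer as ℤ
import Data.Integer.Properties as ℤ
open import Data.List using (List; []; _∷_; _∷ʳ_; _++_; map; length; allFin; tabulate; upTo; take)
open import Data.List.Membership.Propositional using () renaming (_∈_ to _∈ₗ_)
open import Data.List.Membership.Propositional.Properties using (∈-map⁺; ∈-++⁺ˡ; ∈-++⁺ʳ; ∈-allFin)
open import Data.List.Properties using (map-tabulate; map-cong; length-map)
open import Data.List.Relation.Binary.Permutation.Propositional
  using (_↭_; prep; swap; ↭-refl; ↭-trans; ↭-sym; ↭⇒↭ₛ)
open import Data.List.Relation.Binary.Permutation.Propositional.Properties using (∈-resp-↭; ∷↭∷ʳ; shifts)
open import Data.List.Relation.Binary.Permutation.Setoid.Properties using (Unique-resp-↭)
open import Data.List.Relation.Unary.All as All using (All; []; _∷_)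
import Data.List.Relation.Unary.All.Properties as All
open import Data.List.Relation.Unary.All.Properties using (¬Any⇒All¬; All¬⇒¬Any)
open import Data.List.Relation.Unary.AllPairs using ([]; _∷_)
open import Data.List.Relation.Unary.Any using (here; there)
open import Data.List.Relation.Unary.Unique.DecPropositional using (unique?)
open import Data.List.Relation.Unary.Unique.Propositional using (Unique)
import Data.Nat
open import Data.Nat as ℕ using (ℕ; zero; suc; _≤_; _<_; _≡ᵇ_; z≤n; s≤s)
open import Data.Nat.Combinatorics using (_C_; nCk+nC[k+1]≡[n+1]C[k+1])
open import Data.Nat.Coprimality using (1-coprimeTo) renaming (sym to coprime-sym)
open import Data.Nat.ListAction using (sum)
open import Data.Nat.Properties
  using (≡ᵇ⇒≡; ≡⇒≡ᵇ; ≤-refl; ≤-reflexive; ≤-trans; <-irrefl; n≤1+n; suc-injective; +-identityʳ; +-suc;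
         +-assoc; +-mono-≤; +-monoʳ-≤; +-monoʳ-<; +-cancelʳ-<; m<m+n; *-zeroʳ; *-identityˡ; *-distribˡ-+;
         *-distribʳ-+; *-monoˡ-≤; *-cancelˡ-<; module ≤-Reasoning)
open import Data.Product using (∃; _×_; _,_; proj₁; proj₂)
open import Data.Product.Properties using () renaming (≡-dec to ×-≡-dec)
open import Data.Rational using (ℚ; 0ℚ; 1ℚ; _+_; _-_; _*_; -_; _/_; mkℚ; 1/_)
import Data.Rational.Properties as ℚ
open import Data.Rational.Solver using (module +-*-Solver)
open import Data.Sum using (inj₁; inj₂)
open import Data.Vec using (Vec; []; _∷_; lookup; insertAt; toList; here; there)
import Data.Vec.Membership.Propositional.Properties as Vec
open import Data.Vec.Properties using ([]=⇒lookup; lookup⇒[]=; insertAt-punchIn)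
open import Function using (_∘_; id; _⇔_; mk⇔; Equivalence; Injective)
open import Relation.Binary.PropositionalEquality
open import Relation.Binary.PropositionalEquality.Properties using (setoid)
open import Relation.Nullary using (does; yes; no)
open import Relation.Nullary.Decidable using (from-yes)

open import Algebra.Properties.Semiring.Sum (Ring.semiring ℚ.+-*-ring)
  using (∑-distrib-+; *-distribˡ-sum; sum-replicate-zero) renaming (sum to ∑)
open import Algebra.Properties.Semiring.Mult (Ring.semiring ℚ.+-*-ring)
  using (×-comm-*; ×-assoc-*) renaming (_×_ to _·_)
open import Algebra.Solver.Monoid (CommutativeMonoid.monoid ∨-commutativeMonoid)
  using (_⊕_; _⊜_) renaming (solve to ∨-solve; id to ε)
open +-*-Solver using (solve; _:+_; _:*_; _:-_; con; _:=_)

private variable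
  n m : ℕ
  x : Fin n
  p q s t : Subset n

½ ⅓ ⅙ -⅙ : ℚ
½  = + 1 / 2
⅓  = + 1 / 3
⅙  = + 1 / 6
-⅙ = - ⅙

-- Sums over the vertex set

ΣV-suc : ∀ {n} (f : Fin (suc n) → ℚ) → ΣV f ≡ f zero + ΣV (f ∘ suc)
ΣV-suc f = cong (λ xs → f zero + sumℚ xs) (trans (map-tabulate suc f) (sym (map-tabulate id (f ∘ suc))))

ΣV≡∑ : ∀ {n} (f : Fin n → ℚ) → ΣV f ≡ ∑ f
ΣV≡∑ {zero}  f = refl
ΣV≡∑ {suc n} f = trans (ΣV-suc f) (cong (_+_ (f zero)) (ΣV≡∑ (f ∘ suc)))

ΣV-cong : ∀ {n} {f g : Fin n → ℚ} → (∀ v → f v ≡ g v) → ΣV f ≡ ΣV g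
ΣV-cong {n} f≗g = cong sumℚ (map-cong f≗g (allFin n))

ΣV-distrib-+ : ∀ {n} (f g : Fin n → ℚ) → ΣV (λ v → f v + g v) ≡ ΣV f + ΣV g
ΣV-distrib-+ f g = begin
  ΣV (λ v → f v + g v)  ≡⟨ ΣV≡∑ (λ v → f v + g v) ⟩
  ∑ (λ v → f v + g v)   ≡⟨ ∑-distrib-+ f g ⟩
  ∑ f + ∑ g             ≡⟨ cong₂ _+_ (ΣV≡∑ f) (ΣV≡∑ g) ⟨
  ΣV f + ΣV g           ∎
  where open ≡-Reasoning

ΣV-neg : ∀ {n} (f : Fin n → ℚ) → ΣV (λ v → - f v) ≡ - ΣV f
ΣV-neg {zero}  f = refl
ΣV-neg {suc n} f = begin
  ΣV (λ v → - f v)                   ≡⟨ ΣV-suc (λ v → - f v) ⟩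
  - f zero + ΣV (λ v → - f (suc v))  ≡⟨ cong (_+_ (- f zero)) (ΣV-neg (f ∘ suc)) ⟩
  - f zero + - ΣV (f ∘ suc)          ≡⟨ ℚ.neg-distrib-+ (f zero) _ ⟨
  - (f zero + ΣV (f ∘ suc))          ≡⟨ cong -_ (ΣV-suc f) ⟨
  - ΣV f                             ∎
  where open ≡-Reasoning

ΣV-distrib-- : ∀ {n} (f g : Fin n → ℚ) → ΣV (λ v → f v - g v) ≡ ΣV f - ΣV g
ΣV-distrib-- f g = trans (ΣV-distrib-+ f (λ v → - g v)) (cong (_+_ (ΣV f)) (ΣV-neg g))

*-distribˡ-ΣV : ∀ {n} c (f : Fin n → ℚ) → c * ΣV f ≡ ΣV (λ v → c * f v)
*-distribˡ-ΣV c f = begin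
  c * ΣV f             ≡⟨ cong (c *_) (ΣV≡∑ f) ⟩
  c * ∑ f              ≡⟨ *-distribˡ-sum c f ⟩
  ∑ (λ v → c * f v)    ≡⟨ ΣV≡∑ (λ v → c * f v) ⟨
  ΣV (λ v → c * f v)   ∎
  where open ≡-Reasoning

ΣV-zero : ∀ n → ΣV {n} (λ _ → 0ℚ) ≡ 0ℚ
ΣV-zero n = trans (ΣV≡∑ {n} (λ _ → 0ℚ)) (sum-replicate-zero n)

ΣV-δ : ∀ {n} (a : Fin n) (f : Fin n → ℚ) → ΣV (λ v → if does (v ≟ a) then f v else 0ℚ) ≡ f a
ΣV-δ {suc n} zero f = begin
  ΣV (λ v → if does (v ≟ zero) then f v else 0ℚ)  ≡⟨ ΣV-suc (λ v → if does (v ≟ zero) then f v else 0ℚ) ⟩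
  f zero + ΣV {n} (λ _ → 0ℚ)                      ≡⟨ cong (_+_ (f zero)) (ΣV-zero n) ⟩
  f zero + 0ℚ                                     ≡⟨ ℚ.+-identityʳ (f zero) ⟩
  f zero                                          ∎
  where open ≡-Reasoning
ΣV-δ {suc n} (suc a) f = begin
  ΣV (λ v → if does (v ≟ suc a) then f v else 0ℚ)         ≡⟨ ΣV-suc (λ v → if does (v ≟ suc a) then f v else 0ℚ) ⟩
  0ℚ + ΣV (λ v → if does (v ≟ a) then f (suc v) else 0ℚ)  ≡⟨ ℚ.+-identityˡ _ ⟩
  ΣV (λ v → if does (v ≟ a) then f (suc v) else 0ℚ)       ≡⟨ ΣV-δ a (f ∘ suc) ⟩
  f (suc a)                                               ∎
  where open ≡-Reasoning

filterᵇ-map : ∀ {A B : Set} (P : B → Bool) (f : A → B) (xs : List A) →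
              filterᵇ P (map f xs) ≡ map f (filterᵇ (P ∘ f) xs)
filterᵇ-map P f []       = refl
filterᵇ-map P f (x ∷ xs) with P (f x)
... | true  = cong (f x ∷_) (filterᵇ-map P f xs)
... | false = filterᵇ-map P f xs

length-filterᵇ-tabulate-suc : ∀ {n} (P : Fin (suc n) → Bool) →
                              length (filterᵇ P (tabulate suc)) ≡ countV (P ∘ suc)
length-filterᵇ-tabulate-suc {n} P = begin
  length (filterᵇ P (tabulate suc))                ≡⟨ cong (length ∘ filterᵇ P) (map-tabulate id suc) ⟨
  length (filterᵇ P (map suc (allFin n)))          ≡⟨ cong length (filterᵇ-map P suc (allFin n)) ⟩
  length (map suc (filterᵇ (P ∘ suc) (allFin n)))  ≡⟨ length-map (Fin.suc {n}) (filterᵇ (P ∘ suc) (allFin n)) ⟩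
  countV (P ∘ suc)                                 ∎
  where open ≡-Reasoning

countV-suc : ∀ {n} (P : Fin (suc n) → Bool) →
             countV P ≡ (if P zero then suc (countV (P ∘ suc)) else countV (P ∘ suc))
countV-suc P with P zero
... | true  = cong suc (length-filterᵇ-tabulate-suc P)
... | false = length-filterᵇ-tabulate-suc P

·-1ℚ : ∀ m → m · 1ℚ ≡ mkℚ (ℤ.+ m) 0 (coprime-sym (1-coprimeTo m))
·-1ℚ zero    = refl
·-1ℚ (suc m) rewrite ·-1ℚ m =
  trans (ℚ./-cong {q₁ = 1} {q₂ = 1} (cong (ℤ._+_ ℤ.1ℤ) (ℤ.*-identityʳ (ℤ.+ m))) refl) (ℚ.normalize-coprime _)

·-inv : ∀ k → suc k · inv (suc k) ≡ 1ℚ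
·-inv k = begin
  suc k · inv (suc k)         ≡⟨ cong (suc k ·_) (ℚ.*-identityˡ (inv (suc k))) ⟨
  suc k · (1ℚ * inv (suc k))  ≡⟨ ×-assoc-* (suc k) 1ℚ (inv (suc k)) ⟨
  (suc k · 1ℚ) * inv (suc k)  ≡⟨ cong₂ _*_ (·-1ℚ (suc k)) (ℚ.normalize-coprime (1-coprimeTo (suc k))) ⟩
  r * 1/ r                    ≡⟨ ℚ.*-inverseʳ r ⟩
  1ℚ                          ∎
  where
  open ≡-Reasoning
  r = mkℚ (ℤ.+ suc k) 0 (coprime-sym (1-coprimeTo (suc k)))

if-distrib : ∀ (_⊙_ : ℚ → ℚ → ℚ) → 0ℚ ⊙ 0ℚ ≡ 0ℚ → ∀ b a c →
             (if b then a ⊙ c else 0ℚ) ≡ (if b then a else 0ℚ) ⊙ (if b then c else 0ℚ)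
if-distrib _⊙_ _       true  a c = refl
if-distrib _⊙_ 0⊙0≡0 false a c = sym 0⊙0≡0

ΣV[]-cong : ∀ {n} (P : Fin n → Bool) {f g : Fin n → ℚ} → (∀ v → P v ≡ true → f v ≡ g v) →
            ΣV[ P ] f ≡ ΣV[ P ] g
ΣV[]-cong P {f} {g} f≗g = ΣV-cong on-P
  where
  on-P : ∀ v → (if P v then f v else 0ℚ) ≡ (if P v then g v else 0ℚ)
  on-P v with P v in Pv
  ... | true  = f≗g v Pv
  ... | false = refl

ΣV[]-distrib-+ : ∀ {n} (P : Fin n → Bool) (f g : Fin n → ℚ) →
                 ΣV[ P ] (λ v → f v + g v) ≡ ΣV[ P ] f + ΣV[ P ] g
ΣV[]-distrib-+ {n} P f g =
  trans (ΣV-cong (λ v → if-distrib _+_ refl (P v) (f v) (g v))) (ΣV-distrib-+ {n} _ _)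

ΣV[]-distrib-- : ∀ {n} (P : Fin n → Bool) (f g : Fin n → ℚ) →
                 ΣV[ P ] (λ v → f v - g v) ≡ ΣV[ P ] f - ΣV[ P ] g
ΣV[]-distrib-- {n} P f g =
  trans (ΣV-cong (λ v → if-distrib _-_ refl (P v) (f v) (g v))) (ΣV-distrib-- {n} _ _)

ΣV[]-*ʳ : ∀ {n} (P : Fin n → Bool) (f : Fin n → ℚ) c → ΣV[ P ] (λ v → f v * c) ≡ ΣV[ P ] f * c
ΣV[]-*ʳ {n} P f c = begin
  ΣV[ P ] (λ v → f v * c)                   ≡⟨ ΣV-cong if-* ⟩
  ΣV (λ v → c * (if P v then f v else 0ℚ))  ≡⟨ *-distribˡ-ΣV {n} c _ ⟨
  c * ΣV[ P ] f                             ≡⟨ ℚ.*-comm c (ΣV[ P ] f) ⟩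
  ΣV[ P ] f * c                             ∎
  where
  open ≡-Reasoning
  if-* : ∀ v → (if P v then f v * c else 0ℚ) ≡ c * (if P v then f v else 0ℚ)
  if-* v with P v
  ... | true  = ℚ.*-comm (f v) c
  ... | false = sym (ℚ.*-zeroʳ c)

ΣV[]-const : ∀ {n} (P : Fin n → Bool) c → ΣV[ P ] (λ _ → c) ≡ countV P · c
ΣV[]-const {zero}  P c = refl
ΣV[]-const {suc n} P c
  rewrite ΣV-suc (λ v → if P v then c else 0ℚ) | ΣV[]-const (P ∘ suc) c | countV-suc P
  with P zero
... | true  = refl
... | false = ℚ.+-identityˡ _

ΣV[]-cancel : ∀ {n} (P : Fin n → Bool) c → 0 < countV P → ΣV[ P ] (λ _ → c * inv (countV P)) ≡ c
ΣV[]-cancel P c _ with countV P | ΣV[]-const P (c * inv (countV P))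
... | suc k | Σ≡ = begin
  ΣV[ P ] (λ _ → c * inv (suc k))  ≡⟨ Σ≡ ⟩
  suc k · (c * inv (suc k))        ≡⟨ ×-comm-* (suc k) c (inv (suc k)) ⟨
  c * (suc k · inv (suc k))        ≡⟨ cong (c *_) (·-inv k) ⟩
  c * 1ℚ                           ≡⟨ ℚ.*-identityʳ c ⟩
  c                                ∎
  where open ≡-Reasoning

ΣV-nested-∧ : ∀ {n} (P : Fin n → Bool) (Q : Fin n → Fin n → Bool) (f : Fin n → Fin n → ℚ) →
              ΣV (λ y → ΣV (λ z → if P y ∧ Q y z then f y z else 0ℚ)) ≡ ΣV[ P ] (λ y → ΣV[ Q y ] (f y))
ΣV-nested-∧ {n} P Q f = ΣV-cong (λ y → split y (P y))
  where
  split : ∀ y b → ΣV (λ z → if b ∧ Q y z then f y z else 0ℚ) ≡ (if b then ΣV[ Q y ] (f y) else 0ℚ)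
  split y true  = refl
  split y false = ΣV-zero n

ΣV[]-linear₂ : ∀ {n} (P : Fin n → Bool) (a b c : Fin n → ℚ) →
               ΣV[ P ] (λ v → (a v - b v) + c v) ≡ (ΣV[ P ] a - ΣV[ P ] b) + ΣV[ P ] c
ΣV[]-linear₂ P a b c =
  trans (ΣV[]-distrib-+ P (λ v → a v - b v) c) (cong (_+ ΣV[ P ] c) (ΣV[]-distrib-- P a b))

ΣV[]-linear₃ : ∀ {n} (P : Fin n → Bool) (a b c d : Fin n → ℚ) →
               ΣV[ P ] (λ v → ((a v - b v) + c v) - d v) ≡ ((ΣV[ P ] a - ΣV[ P ] b) + ΣV[ P ] c) - ΣV[ P ] d
ΣV[]-linear₃ P a b c d =
  trans (ΣV[]-distrib-- P (λ v → (a v - b v) + c v) d) (cong (_- ΣV[ P ] d) (ΣV[]-linear₂ P a b c))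

ΣVⁿ : ∀ {n} m → (Vec (Fin n) m → ℚ) → ℚ
ΣVⁿ zero    F = F []
ΣVⁿ (suc m) F = ΣV (λ a → ΣVⁿ m (λ w → F (a ∷ w)))

ΣVⁿ-cong : ∀ {n} m {F G : Vec (Fin n) m → ℚ} → (∀ w → F w ≡ G w) → ΣVⁿ m F ≡ ΣVⁿ m G
ΣVⁿ-cong zero    F≗G = F≗G []
ΣVⁿ-cong (suc m) F≗G = ΣV-cong (λ a → ΣVⁿ-cong m (λ w → F≗G (a ∷ w)))

ΣVⁿ-zero : ∀ {n} m → ΣVⁿ {n} m (λ _ → 0ℚ) ≡ 0ℚ
ΣVⁿ-zero     zero    = refl
ΣVⁿ-zero {n} (suc m) = trans (ΣV-cong {n} (λ _ → ΣVⁿ-zero m)) (ΣV-zero n)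

ΣVⁿ-distrib-+ : ∀ {n} m (F G : Vec (Fin n) m → ℚ) → ΣVⁿ m (λ w → F w + G w) ≡ ΣVⁿ m F + ΣVⁿ m G
ΣVⁿ-distrib-+     zero    F G = refl
ΣVⁿ-distrib-+ {n} (suc m) F G =
  trans (ΣV-cong (λ a → ΣVⁿ-distrib-+ m (λ w → F (a ∷ w)) (λ w → G (a ∷ w)))) (ΣV-distrib-+ {n} _ _)

ΣVⁿ-if : ∀ {n} m b (F : Vec (Fin n) m → ℚ) → ΣVⁿ m (λ w → if b then F w else 0ℚ) ≡ (if b then ΣVⁿ m F else 0ℚ)
ΣVⁿ-if m true  F = refl
ΣVⁿ-if m false F = ΣVⁿ-zero m

ΣVⁿ-δ : ∀ {n m} (i : Fin (suc m)) (a : Fin n) (F : Vec (Fin n) (suc m) → ℚ) →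
        ΣVⁿ (suc m) (λ v → if does (lookup v i ≟ a) then F v else 0ℚ) ≡ ΣVⁿ m (λ w → F (insertAt w i a))
ΣVⁿ-δ {n} {m} zero a F = begin
  ΣV (λ b → ΣVⁿ m (λ w → if does (b ≟ a) then F (b ∷ w) else 0ℚ))  ≡⟨ ΣV-cong {n} (λ b → ΣVⁿ-if m _ _) ⟩
  ΣV (λ b → if does (b ≟ a) then ΣVⁿ m (λ w → F (b ∷ w)) else 0ℚ)  ≡⟨ ΣV-δ {n} a _ ⟩
  ΣVⁿ m (λ w → F (a ∷ w))                                          ∎
  where open ≡-Reasoning
ΣVⁿ-δ {m = suc m} (suc i) a F = ΣV-cong (λ b → ΣVⁿ-δ i a (λ w → F (b ∷ w)))

ΣVⁿ-comm-sumℚ : ∀ {n} m {A : Set} (f : A → Vec (Fin n) m → ℚ) (xs : List A) →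
                ΣVⁿ m (λ w → sumℚ (map (λ a → f a w) xs)) ≡ sumℚ (map (λ a → ΣVⁿ m (f a)) xs)
ΣVⁿ-comm-sumℚ m f []       = ΣVⁿ-zero m
ΣVⁿ-comm-sumℚ m f (a ∷ xs) =
  trans (ΣVⁿ-distrib-+ m (f a) _) (cong (_+_ (ΣVⁿ m (f a))) (ΣVⁿ-comm-sumℚ m f xs))

sumℚ-zero : ∀ {A : Set} (f : A → ℚ) (xs : List A) → (∀ {a} → a ∈ₗ xs → f a ≡ 0ℚ) → sumℚ (map f xs) ≡ 0ℚ
sumℚ-zero f []       _   = refl
sumℚ-zero f (x ∷ xs) f≡0 = cong₂ _+_ (f≡0 (here refl)) (sumℚ-zero f xs (λ a∈xs → f≡0 (there a∈xs)))

if-any≡sum : ∀ {A : Set} (P : A → Bool) {xs : List A} → Unique xs →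
             (∀ {a b} → P a ≡ true → P b ≡ true → a ≡ b) →
             ∀ c → (if any P xs then c else 0ℚ) ≡ sumℚ (map (λ a → if P a then c else 0ℚ) xs)
if-any≡sum P {[]}     _             _           c = refl
if-any≡sum P {x ∷ xs} (x∉xs ∷ uniq) P-at-most-1 c with P x in Px
... | true  = sym (trans (cong (_+_ c) (sumℚ-zero _ xs none)) (ℚ.+-identityʳ c))
  where
  none : ∀ {a} → a ∈ₗ xs → (if P a then c else 0ℚ) ≡ 0ℚ
  none {a} a∈xs with P a in Pa
  ... | true  = ⊥-elim (All.lookup x∉xs a∈xs (P-at-most-1 Px Pa))
  ... | false = refl
... | false = trans (if-any≡sum P uniq P-at-most-1 c) (sym (ℚ.+-identityˡ _))

-- Subsets

∧≡true⁻ : ∀ {a b} → a ∧ b ≡ true → a ≡ true × b ≡ true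
∧≡true⁻ {true} b≡true = refl , b≡true

≡ᵇ≡true⇒≡ : ∀ {m k} → (m ≡ᵇ k) ≡ true → m ≡ k
≡ᵇ≡true⇒≡ {m} {k} h = ≡ᵇ⇒≡ m k (Equivalence.from T-≡ h)

∈ᵇ⇒∈ : (x ∈ᵇ s) ≡ true → x ∈ s
∈ᵇ⇒∈ = lookup⇒[]= _ _

∈⇒∈ᵇ : x ∈ s → (x ∈ᵇ s) ≡ true
∈⇒∈ᵇ = []=⇒lookup

∉⇒∈ᵇ≡false : x ∉ s → (x ∈ᵇ s) ≡ false
∉⇒∈ᵇ≡false {x = x} {s} x∉s with x ∈ᵇ s in x∈ᵇs
... | true  = ⊥-elim (x∉s (∈ᵇ⇒∈ x∈ᵇs))
... | false = refl

⊆ᵇ⇒⊆ : (s ⊆ᵇ t) ≡ true → s ⊆ t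
⊆ᵇ⇒⊆ {s = inside  ∷ s} {inside ∷ t} s⊆t here        = here
⊆ᵇ⇒⊆ {s = inside  ∷ s} {inside ∷ t} s⊆t (there x∈s) = there (⊆ᵇ⇒⊆ s⊆t x∈s)
⊆ᵇ⇒⊆ {s = outside ∷ s} {_      ∷ t} s⊆t (there x∈s) = there (⊆ᵇ⇒⊆ s⊆t x∈s)

⊆⇒⊆ᵇ : s ⊆ t → (s ⊆ᵇ t) ≡ true
⊆⇒⊆ᵇ {s = []}          {[]}          s⊆t = refl
⊆⇒⊆ᵇ {s = inside  ∷ s} {inside  ∷ t} s⊆t = ⊆⇒⊆ᵇ (drop-∷-⊆ s⊆t)
⊆⇒⊆ᵇ {s = inside  ∷ s} {outside ∷ t} s⊆t with s⊆t here
... | ()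
⊆⇒⊆ᵇ {s = outside ∷ s} {_       ∷ t} s⊆t = ⊆⇒⊆ᵇ (drop-∷-⊆ s⊆t)

∈-setOf⁺ : ∀ {xs : List (Fin n)} → x ∈ₗ xs → x ∈ setOf xs
∈-setOf⁺ {x = x} (here refl) = x∈p∪q⁺ (inj₁ (x∈⁅x⁆ x))
∈-setOf⁺ (there x∈xs)        = x∈p∪q⁺ (inj₂ (∈-setOf⁺ x∈xs))

∈-setOf⁻ : ∀ (xs : List (Fin n)) → x ∈ setOf xs → x ∈ₗ xs
∈-setOf⁻ []       x∈∅ = ⊥-elim (∉⊥ x∈∅)
∈-setOf⁻ (y ∷ ys) x∈y∷ys with x∈p∪q⁻ ⁅ y ⁆ (setOf ys) x∈y∷ys
... | inj₁ x∈⁅y⁆ = here (x∈⁅y⁆⇒x≡y y x∈⁅y⁆)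
... | inj₂ x∈ys  = there (∈-setOf⁻ ys x∈ys)

∉setOf⇒All≢ : ∀ {xs : List (Fin n)} → x ∉ setOf xs → All (x ≢_) xs
∉setOf⇒All≢ {xs = xs} x∉ = ¬Any⇒All¬ xs (λ x∈xs → x∉ (∈-setOf⁺ x∈xs))

All≢⇒∉setOf : ∀ {xs : List (Fin n)} → All (x ≢_) xs → x ∉ setOf xs
All≢⇒∉setOf {xs = xs} x≢xs x∈ = All¬⇒¬Any x≢xs (∈-setOf⁻ xs x∈)

setOf-↭ : ∀ {xs ys : List (Fin n)} → xs ↭ ys → setOf xs ≡ setOf ys
setOf-↭ {xs = xs} {ys} xs↭ys = ⊆-antisym
  (λ x∈xs → ∈-setOf⁺ (∈-resp-↭ xs↭ys (∈-setOf⁻ xs x∈xs)))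
  (λ x∈ys → ∈-setOf⁺ (∈-resp-↭ (↭-sym xs↭ys) (∈-setOf⁻ ys x∈ys)))

setOf-∷ʳ : ∀ (xs : List (Fin n)) x → setOf (xs ∷ʳ x) ≡ setOf xs ∪ ⁅ x ⁆
setOf-∷ʳ xs x = trans (sym (setOf-↭ (∷↭∷ʳ x xs))) (∪-comm ⁅ x ⁆ (setOf xs))

∣⁅x⁆∪p∣ : x ∉ p → ∣ ⁅ x ⁆ ∪ p ∣ ≡ suc ∣ p ∣
∣⁅x⁆∪p∣ {x = zero}  {outside ∷ p} x∉p = cong (λ q → suc ∣ q ∣) (∪-identityˡ p)
∣⁅x⁆∪p∣ {x = zero}  {inside  ∷ p} x∉p = ⊥-elim (x∉p here)
∣⁅x⁆∪p∣ {x = suc x} {outside ∷ p} x∉p = ∣⁅x⁆∪p∣ (λ x∈p → x∉p (there x∈p))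
∣⁅x⁆∪p∣ {x = suc x} {inside  ∷ p} x∉p = cong suc (∣⁅x⁆∪p∣ (λ x∈p → x∉p (there x∈p)))

∣setOf∣ : ∀ {xs : List (Fin n)} → Unique xs → ∣ setOf xs ∣ ≡ length xs
∣setOf∣ {n} {[]}          []            = ∣⊥∣≡0 n
∣setOf∣     {xs = x ∷ xs} (x∉xs ∷ uniq) = trans (∣⁅x⁆∪p∣ (All≢⇒∉setOf x∉xs)) (cong suc (∣setOf∣ uniq))

private
  ∈∖-there : ∀ {a b} → (∃ λ x → x ∈ q × x ∉ p) → ∃ λ x → x ∈ b ∷ q × x ∉ a ∷ p
  ∈∖-there (x , x∈q , x∉p) = suc x , there x∈q , λ { (there x∈p) → x∉p x∈p }

∣p∣<∣q∣⇒∃x∈q∖p : ∣ p ∣ < ∣ q ∣ → ∃ λ x → x ∈ q × x ∉ p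
∣p∣<∣q∣⇒∃x∈q∖p {p = outside ∷ p} {inside  ∷ q} _           = zero , here , λ ()
∣p∣<∣q∣⇒∃x∈q∖p {p = inside  ∷ p} {inside  ∷ q} (s≤s ∣p∣<∣q∣) = ∈∖-there (∣p∣<∣q∣⇒∃x∈q∖p ∣p∣<∣q∣)
∣p∣<∣q∣⇒∃x∈q∖p {p = outside ∷ p} {outside ∷ q} ∣p∣<∣q∣       = ∈∖-there (∣p∣<∣q∣⇒∃x∈q∖p ∣p∣<∣q∣)
∣p∣<∣q∣⇒∃x∈q∖p {p = inside  ∷ p} {outside ∷ q} 1+∣p∣<∣q∣     =
  ∈∖-there (∣p∣<∣q∣⇒∃x∈q∖p (≤-trans (n≤1+n _) 1+∣p∣<∣q∣))

p⊆q∧∣q∣≤∣p∣⇒p≡q : p ⊆ q → ∣ q ∣ ≤ ∣ p ∣ → p ≡ q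
p⊆q∧∣q∣≤∣p∣⇒p≡q {p = []}          {[]}          _   _               = refl
p⊆q∧∣q∣≤∣p∣⇒p≡q {p = inside  ∷ p} {inside  ∷ q} p⊆q (s≤s ∣q∣≤∣p∣) =
  cong (inside ∷_) (p⊆q∧∣q∣≤∣p∣⇒p≡q (drop-∷-⊆ p⊆q) ∣q∣≤∣p∣)
p⊆q∧∣q∣≤∣p∣⇒p≡q {p = outside ∷ p} {outside ∷ q} p⊆q ∣q∣≤∣p∣         =
  cong (outside ∷_) (p⊆q∧∣q∣≤∣p∣⇒p≡q (drop-∷-⊆ p⊆q) ∣q∣≤∣p∣)
p⊆q∧∣q∣≤∣p∣⇒p≡q {p = inside  ∷ p} {outside ∷ q} p⊆q _ with p⊆q here
... | ()
p⊆q∧∣q∣≤∣p∣⇒p≡q {p = outside ∷ p} {inside  ∷ q} p⊆q ∣q∣<∣p∣         =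
  ⊥-elim (<-irrefl refl (≤-trans ∣q∣<∣p∣ (p⊆q⇒∣p∣≤∣q∣ (drop-∷-⊆ p⊆q))))

x∈p─q⇒x∉q : ∀ (p q : Subset n) → x ∈ p ─ q → x ∉ q
x∈p─q⇒x∉q (inside ∷ p) (outside ∷ q) here          ()
x∈p─q⇒x∉q (_      ∷ p) (_       ∷ q) (there x∈p─q) (there x∈q) = x∈p─q⇒x∉q p q x∈p─q x∈q

x∉p∖x : ∀ (p : Subset n) → x ∉ p ∖ x
x∉p∖x {x = x} p x∈p∖x = x∈p─q⇒x∉q p ⁅ x ⁆ x∈p∖x (x∈⁅x⁆ x)

⁅x⁆∪p∖x≡p : x ∈ p → ⁅ x ⁆ ∪ (p ∖ x) ≡ p
⁅x⁆∪p∖x≡p {x = x} {p = p} x∈p = ⊆-antisym ⊆p p⊆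
  where
  ⊆p : ⁅ x ⁆ ∪ (p ∖ x) ⊆ p
  ⊆p y∈ with x∈p∪q⁻ ⁅ x ⁆ (p ∖ x) y∈
  ... | inj₁ y∈⁅x⁆ rewrite x∈⁅y⁆⇒x≡y x y∈⁅x⁆ = x∈p
  ... | inj₂ y∈p∖x = p─q⊆p p ⁅ x ⁆ y∈p∖x
  p⊆ : p ⊆ ⁅ x ⁆ ∪ (p ∖ x)
  p⊆ {y} y∈p with y ≟ x
  ... | yes refl = x∈p∪q⁺ (inj₁ (x∈⁅x⁆ x))
  ... | no  y≢x  = x∈p∪q⁺ (inj₂ (x∈p∧x≢y⇒x∈p-y y∈p y≢x))

∣p∖x∣ : x ∈ p → suc ∣ p ∖ x ∣ ≡ ∣ p ∣
∣p∖x∣ {p = p} x∈p = trans (sym (∣⁅x⁆∪p∣ (x∉p∖x p))) (cong ∣_∣ (⁅x⁆∪p∖x≡p x∈p))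

allSubsets-complete : ∀ (t : Subset n) → t ∈ₗ allSubsets n
allSubsets-complete         []          = here refl
allSubsets-complete {suc n} (true ∷ t)  = ∈-++⁺ˡ (∈-map⁺ (true ∷_) (allSubsets-complete t))
allSubsets-complete {suc n} (false ∷ t) =
  ∈-++⁺ʳ (map (true ∷_) (allSubsets n)) (∈-map⁺ (false ∷_) (allSubsets-complete t))

module _ {A : Set} (f : A → Bool) where

  all≡true⁻ : ∀ {xs y} → all f xs ≡ true → y ∈ₗ xs → f y ≡ true
  all≡true⁻ {x ∷ xs} all≡ (here refl)  = proj₁ (∧≡true⁻ all≡)
  all≡true⁻ {x ∷ xs} all≡ (there y∈xs) = all≡true⁻ (proj₂ (∧≡true⁻ {f x} all≡)) y∈xs

  all≡true⁺ : ∀ xs → (∀ {y} → y ∈ₗ xs → f y ≡ true) → all f xs ≡ true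
  all≡true⁺ []       _ = refl
  all≡true⁺ (x ∷ xs) h rewrite h (here refl) = all≡true⁺ xs (λ y∈xs → h (there y∈xs))

module _ {A : Set} (P : A → Bool) where

  ∈-filterᵇ⁺ : ∀ {xs y} → y ∈ₗ xs → P y ≡ true → y ∈ₗ filterᵇ P xs
  ∈-filterᵇ⁺ {x ∷ xs} (here refl) Py rewrite Py = here refl
  ∈-filterᵇ⁺ {x ∷ xs} (there y∈xs) Py with P x
  ... | true  = there (∈-filterᵇ⁺ y∈xs Py)
  ... | false = ∈-filterᵇ⁺ y∈xs Py

  ∈-filterᵇ⁻ : ∀ {xs y} → y ∈ₗ filterᵇ P xs → P y ≡ true
  ∈-filterᵇ⁻ {x ∷ xs} y∈ with P x in Px
  ∈-filterᵇ⁻ {x ∷ xs} (here refl)  | true  = Px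
  ∈-filterᵇ⁻ {x ∷ xs} (there y∈xs) | true  = ∈-filterᵇ⁻ {xs} y∈xs
  ∈-filterᵇ⁻ {x ∷ xs} y∈xs         | false = ∈-filterᵇ⁻ {xs} y∈xs

∈-subsetsOfSize⁺ : ∀ {k} → ∣ t ∣ ≡ k → t ⊆ s → t ∈ₗ subsetsOfSize k s
∈-subsetsOfSize⁺ {t = t} ∣t∣≡k t⊆s =
  ∈-filterᵇ⁺ _ (allSubsets-complete t) (cong₂ _∧_ (Equivalence.to T-≡ (≡⇒≡ᵇ _ _ ∣t∣≡k)) (⊆⇒⊆ᵇ t⊆s))

∈-subsetsOfSize⁻ : ∀ {k} → t ∈ₗ subsetsOfSize k s → ∣ t ∣ ≡ k × t ⊆ s
∈-subsetsOfSize⁻ {n} {t} {k = k} t∈ =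
  let ∣t∣≡ᵇk , t⊆ᵇs = ∧≡true⁻ {∣ t ∣ ≡ᵇ k} (∈-filterᵇ⁻ _ {allSubsets n} t∈)
  in ≡ᵇ≡true⇒≡ ∣t∣≡ᵇk , ⊆ᵇ⇒⊆ t⊆ᵇs

module _ (f : Subset n → Bool) (k : ℕ) (s : Subset n) where

  all-subsetsOfSize⁻ : all f (subsetsOfSize k s) ≡ true → ∀ t → ∣ t ∣ ≡ k → t ⊆ s → f t ≡ true
  all-subsetsOfSize⁻ all≡ t ∣t∣≡k t⊆s = all≡true⁻ f all≡ (∈-subsetsOfSize⁺ ∣t∣≡k t⊆s)

  all-subsetsOfSize⁺ : (∀ t → ∣ t ∣ ≡ k → t ⊆ s → f t ≡ true) → all f (subsetsOfSize k s) ≡ true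
  all-subsetsOfSize⁺ h = all≡true⁺ f _ λ {t} t∈ → let ∣t∣≡k , t⊆s = ∈-subsetsOfSize⁻ t∈ in h t ∣t∣≡k t⊆s

-- Cliques and common neighbourhoods

module _ {n : ℕ} (H : Hypergraph3 n) where

  private variable
    v : Fin n
    S T : Subset n

  isClique⁻ : isClique H S ≡ true → t ⊆ S → ∣ t ∣ ≡ 3 → E H t ≡ true
  isClique⁻ {S} {t} S-clique t⊆S ∣t∣≡3 = all-subsetsOfSize⁻ (E H) 3 S S-clique t ∣t∣≡3 t⊆S

  isClique⁺ : (∀ {t} → t ⊆ S → ∣ t ∣ ≡ 3 → E H t ≡ true) → isClique H S ≡ true
  isClique⁺ {S} h = all-subsetsOfSize⁺ (E H) 3 S (λ t ∣t∣≡3 t⊆S → h t⊆S ∣t∣≡3)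

  CN⁻ : CN H S v ≡ true → p ⊆ S → ∣ p ∣ ≡ 2 → E H (p ∪ ⁅ v ⁆) ≡ true
  CN⁻ {S} {v} {p} v∈CN p⊆S ∣p∣≡2 = all-subsetsOfSize⁻ (λ p → Nb H p v) 2 S v∈CN p ∣p∣≡2 p⊆S

  CN⁺ : (∀ {p} → p ⊆ S → ∣ p ∣ ≡ 2 → E H (p ∪ ⁅ v ⁆) ≡ true) → CN H S v ≡ true
  CN⁺ {S} {v} h = all-subsetsOfSize⁺ (λ p → Nb H p v) 2 S (λ p ∣p∣≡2 p⊆S → h p⊆S ∣p∣≡2)

  isClique-mono : S ⊆ T → isClique H T ≡ true → isClique H S ≡ true
  isClique-mono S⊆T T-clique = isClique⁺ (λ t⊆S → isClique⁻ T-clique (⊆-trans t⊆S S⊆T))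

  CN⇒∉ : 2 ≤ ∣ S ∣ → CN H S v ≡ true → v ∉ S
  CN⇒∉ {S} {v} 2≤∣S∣ v∈CN v∈S with ∣p∣<∣q∣⇒∃x∈q∖p (subst (_< ∣ S ∣) (sym (∣⁅x⁆∣≡1 v)) 2≤∣S∣)
  ... | s , s∈S , s∉⁅v⁆ = 2≢3 (begin
    2                            ≡⟨ cong suc (∣⁅x⁆∣≡1 v) ⟨
    suc ∣ ⁅ v ⁆ ∣                 ≡⟨ ∣⁅x⁆∪p∣ s∉⁅v⁆ ⟨
    ∣ pair ∣                     ≡⟨ cong ∣_∣ pair∪⁅v⁆≡pair ⟨
    ∣ pair ∪ ⁅ v ⁆ ∣              ≡⟨ uniform H _ (CN⁻ v∈CN pair⊆S (trans (∣⁅x⁆∪p∣ s∉⁅v⁆) (cong suc (∣⁅x⁆∣≡1 v)))) ⟩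
    3                            ∎)
    where
    open ≡-Reasoning
    pair = ⁅ s ⁆ ∪ ⁅ v ⁆
    pair∪⁅v⁆≡pair : pair ∪ ⁅ v ⁆ ≡ pair
    pair∪⁅v⁆≡pair = trans (∪-assoc ⁅ s ⁆ ⁅ v ⁆ ⁅ v ⁆) (cong (⁅ s ⁆ ∪_) (∪-idem ⁅ v ⁆))
    pair⊆S : pair ⊆ S
    pair⊆S x∈pair with x∈p∪q⁻ ⁅ s ⁆ ⁅ v ⁆ x∈pair
    ... | inj₁ x∈⁅s⁆ rewrite x∈⁅y⁆⇒x≡y s x∈⁅s⁆ = s∈S
    ... | inj₂ x∈⁅v⁆ rewrite x∈⁅y⁆⇒x≡y v x∈⁅v⁆ = v∈S
    2≢3 : 2 ≢ 3
    2≢3 ()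

  CN-of-isClique-∪ : v ∉ S → isClique H (S ∪ ⁅ v ⁆) ≡ true → CN H S v ≡ true
  CN-of-isClique-∪ {v} {S} v∉S S∪v-clique = CN⁺ edge
    where
    edge : p ⊆ S → ∣ p ∣ ≡ 2 → E H (p ∪ ⁅ v ⁆) ≡ true
    edge {p} p⊆S ∣p∣≡2 = isClique⁻ S∪v-clique p∪v⊆S∪v
      (trans (cong ∣_∣ (∪-comm p ⁅ v ⁆)) (trans (∣⁅x⁆∪p∣ (λ v∈p → v∉S (p⊆S v∈p))) (cong suc ∣p∣≡2)))
      where
      p∪v⊆S∪v : p ∪ ⁅ v ⁆ ⊆ S ∪ ⁅ v ⁆
      p∪v⊆S∪v x∈ with x∈p∪q⁻ p ⁅ v ⁆ x∈
      ... | inj₁ x∈p = x∈p∪q⁺ (inj₁ (p⊆S x∈p))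
      ... | inj₂ x∈v = x∈p∪q⁺ (inj₂ x∈v)

  isClique-∪⁺ : isClique H S ≡ true → CN H S v ≡ true → isClique H (S ∪ ⁅ v ⁆) ≡ true
  isClique-∪⁺ {S} {v} S-clique v∈CN = isClique⁺ edge
    where
    edge : t ⊆ S ∪ ⁅ v ⁆ → ∣ t ∣ ≡ 3 → E H t ≡ true
    edge {t} t⊆S∪v ∣t∣≡3 with v ∈? t
    ... | no  v∉t = isClique⁻ S-clique t⊆S ∣t∣≡3
      where
      t⊆S : t ⊆ S
      t⊆S {x} x∈t with x∈p∪q⁻ S ⁅ v ⁆ (t⊆S∪v x∈t)
      ... | inj₁ x∈S = x∈S
      ... | inj₂ x∈v rewrite x∈⁅y⁆⇒x≡y v x∈v = ⊥-elim (v∉t x∈t)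
    ... | yes v∈t = subst (λ u → E H u ≡ true) t∖v∪v≡t
                      (CN⁻ v∈CN t∖v⊆S (suc-injective (trans (∣p∖x∣ v∈t) ∣t∣≡3)))
      where
      t∖v∪v≡t : (t ∖ v) ∪ ⁅ v ⁆ ≡ t
      t∖v∪v≡t = trans (∪-comm (t ∖ v) ⁅ v ⁆) (⁅x⁆∪p∖x≡p v∈t)
      t∖v⊆S : t ∖ v ⊆ S
      t∖v⊆S {x} x∈t∖v with x∈p∪q⁻ S ⁅ v ⁆ (t⊆S∪v (p─q⊆p t ⁅ v ⁆ x∈t∖v))
      ... | inj₁ x∈S = x∈S
      ... | inj₂ x∈v rewrite x∈⁅y⁆⇒x≡y v x∈v = ⊥-elim (x∉p∖x t x∈t∖v)

  isClique-∪-CN : v ∉ S → isClique H (S ∪ ⁅ v ⁆) ≡ isClique H S ∧ CN H S v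
  isClique-∪-CN {v} {S} v∉S = ⇔→≡ {z = true} (mk⇔
    (λ S∪v-clique → cong₂ _∧_ (isClique-mono (p⊆p∪q ⁅ v ⁆) S∪v-clique) (CN-of-isClique-∪ v∉S S∪v-clique))
    (λ clique∧CN → let S-clique , v∈CN = ∧≡true⁻ {isClique H S} clique∧CN in isClique-∪⁺ S-clique v∈CN))

-- Counting extensions of cliques

length-filterᵇ-++ : ∀ {A : Set} (P : A → Bool) (xs ys : List A) →
                    length (filterᵇ P (xs ++ ys)) ≡ length (filterᵇ P xs) ℕ.+ length (filterᵇ P ys)
length-filterᵇ-++ P []       ys = refl
length-filterᵇ-++ P (x ∷ xs) ys with P x
... | true  = cong suc (length-filterᵇ-++ P xs ys)
... | false = length-filterᵇ-++ P xs ys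

length-filterᵇ-filterᵇ : ∀ {A : Set} (P Q : A → Bool) (xs : List A) →
                         length (filterᵇ Q (filterᵇ P xs)) ≡ length (filterᵇ (λ x → P x ∧ Q x) xs)
length-filterᵇ-filterᵇ P Q []       = refl
length-filterᵇ-filterᵇ P Q (x ∷ xs) with P x
... | false = length-filterᵇ-filterᵇ P Q xs
... | true with Q x
...   | true  = cong suc (length-filterᵇ-filterᵇ P Q xs)
...   | false = length-filterᵇ-filterᵇ P Q xs

countSubsets : (Subset n → Bool) → ℕ
countSubsets {zero}  P = if P [] then 1 else 0
countSubsets {suc n} P = countSubsets (P ∘ (inside ∷_)) ℕ.+ countSubsets (P ∘ (outside ∷_))

length-filterᵇ-allSubsets : ∀ (P : Subset n → Bool) → length (filterᵇ P (allSubsets n)) ≡ countSubsets P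
length-filterᵇ-allSubsets {zero}  P with P []
... | true  = refl
... | false = refl
length-filterᵇ-allSubsets {suc n} P = begin
  length (filterᵇ P (map (inside ∷_) (allSubsets n) ++ map (outside ∷_) (allSubsets n)))
    ≡⟨ length-filterᵇ-++ P (map (inside ∷_) (allSubsets n)) _ ⟩
  length (filterᵇ P (map (inside ∷_) (allSubsets n))) ℕ.+ length (filterᵇ P (map (outside ∷_) (allSubsets n)))
    ≡⟨ cong₂ ℕ._+_ (restrict inside) (restrict outside) ⟩
  countSubsets (P ∘ (inside ∷_)) ℕ.+ countSubsets (P ∘ (outside ∷_))
    ∎
  where
  open ≡-Reasoning
  restrict : ∀ b → length (filterᵇ P (map (b ∷_) (allSubsets n))) ≡ countSubsets (P ∘ (b ∷_))
  restrict b = trans (cong length (filterᵇ-map P (b ∷_) (allSubsets n)))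
                     (trans (length-map (b ∷_) (filterᵇ (P ∘ (b ∷_)) (allSubsets n)))
                            (length-filterᵇ-allSubsets (P ∘ (b ∷_))))

countSubsets-cong : ∀ {P Q : Subset n → Bool} → (∀ t → P t ≡ Q t) → countSubsets P ≡ countSubsets Q
countSubsets-cong {zero}  P≗Q = cong (λ b → if b then 1 else 0) (P≗Q [])
countSubsets-cong {suc n} P≗Q =
  cong₂ ℕ._+_ (countSubsets-cong (P≗Q ∘ (inside ∷_))) (countSubsets-cong (P≗Q ∘ (outside ∷_)))

countSubsets-none : ∀ (P : Subset n → Bool) → (∀ t → P t ≡ false) → countSubsets P ≡ 0
countSubsets-none {zero}  P none rewrite none [] = refl
countSubsets-none {suc n} P none =
  cong₂ ℕ._+_ (countSubsets-none _ (none ∘ (inside ∷_))) (countSubsets-none _ (none ∘ (outside ∷_)))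

countSubsets-⊇-same-size : ∀ (S : Subset n) (Q : Subset n → Bool) →
  countSubsets (λ T → (S ⊆ᵇ T) ∧ ((∣ T ∣ ≡ᵇ ∣ S ∣) ∧ Q T)) ≡ (if Q S then 1 else 0)
countSubsets-⊇-same-size []            Q = refl
countSubsets-⊇-same-size {suc n} (inside ∷ S)  Q =
  trans (cong₂ ℕ._+_ (countSubsets-⊇-same-size S (Q ∘ (inside ∷_))) (countSubsets-none {n} _ (λ _ → refl)))
        (+-identityʳ _)
countSubsets-⊇-same-size {suc n} (outside ∷ S) Q =
  trans (cong (ℕ._+ countSubsets (λ T → (S ⊆ᵇ T) ∧ ((∣ T ∣ ≡ᵇ ∣ S ∣) ∧ Q (outside ∷ T))))
              (countSubsets-none {n} _ too-big)) (countSubsets-⊇-same-size S (Q ∘ (outside ∷_)))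
  where
  too-big : ∀ T → (S ⊆ᵇ T) ∧ ((suc ∣ T ∣ ≡ᵇ ∣ S ∣) ∧ Q (inside ∷ T)) ≡ false
  too-big T with S ⊆ᵇ T in S⊆T | suc ∣ T ∣ ≡ᵇ ∣ S ∣ in ∣T∣<∣S∣
  ... | false | _     = refl
  ... | true  | false = refl
  ... | true  | true  = ⊥-elim (<-irrefl refl
    (≤-trans (≤-reflexive (≡ᵇ≡true⇒≡ ∣T∣<∣S∣)) (p⊆q⇒∣p∣≤∣q∣ (⊆ᵇ⇒⊆ {s = S} {t = T} S⊆T))))

countSubsets-⊇-one-more : ∀ (S : Subset n) (Q : Subset n → Bool) →
  countSubsets (λ T → (S ⊆ᵇ T) ∧ ((∣ T ∣ ≡ᵇ suc ∣ S ∣) ∧ Q T)) ≡ countV (λ v → not (v ∈ᵇ S) ∧ Q (S ∪ ⁅ v ⁆))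
countSubsets-⊇-one-more []            Q = refl
countSubsets-⊇-one-more {suc n} (inside ∷ S)  Q = begin
  countSubsets (λ T → (S ⊆ᵇ T) ∧ ((∣ T ∣ ≡ᵇ suc ∣ S ∣) ∧ Q (inside ∷ T))) ℕ.+ countSubsets {n} (λ _ → false)
    ≡⟨ cong₂ ℕ._+_ (countSubsets-⊇-one-more S (Q ∘ (inside ∷_))) (countSubsets-none {n} _ (λ _ → refl)) ⟩
  countV (λ v → not (v ∈ᵇ S) ∧ Q (inside ∷ (S ∪ ⁅ v ⁆))) ℕ.+ 0
    ≡⟨ +-identityʳ _ ⟩
  countV (λ v → not (v ∈ᵇ S) ∧ Q (inside ∷ (S ∪ ⁅ v ⁆)))
    ≡⟨ countV-suc (λ v → not (v ∈ᵇ (inside ∷ S)) ∧ Q ((inside ∷ S) ∪ ⁅ v ⁆)) ⟨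
  countV (λ v → not (v ∈ᵇ (inside ∷ S)) ∧ Q ((inside ∷ S) ∪ ⁅ v ⁆))
    ∎
  where open ≡-Reasoning
countSubsets-⊇-one-more {suc n} (outside ∷ S) Q = begin
  countSubsets (λ T → (S ⊆ᵇ T) ∧ ((∣ T ∣ ≡ᵇ ∣ S ∣) ∧ Q (inside ∷ T)))
    ℕ.+ countSubsets (λ T → (S ⊆ᵇ T) ∧ ((∣ T ∣ ≡ᵇ suc ∣ S ∣) ∧ Q (outside ∷ T)))
    ≡⟨ cong₂ ℕ._+_ (countSubsets-⊇-same-size S (Q ∘ (inside ∷_)))
                   (countSubsets-⊇-one-more S (Q ∘ (outside ∷_))) ⟩
  (if Q (inside ∷ S) then 1 else 0) ℕ.+ countV (λ v → not (v ∈ᵇ S) ∧ Q (outside ∷ (S ∪ ⁅ v ⁆)))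
    ≡⟨ add-zero (Q (inside ∷ S)) ⟩
  (if Q (inside ∷ S) then suc c else c)
    ≡⟨ cong (λ U → if Q (inside ∷ U) then suc c else c) (∪-identityʳ S) ⟨
  (if Q (inside ∷ (S ∪ ⊥)) then suc c else c)
    ≡⟨ countV-suc (λ v → not (v ∈ᵇ (outside ∷ S)) ∧ Q ((outside ∷ S) ∪ ⁅ v ⁆)) ⟨
  countV (λ v → not (v ∈ᵇ (outside ∷ S)) ∧ Q ((outside ∷ S) ∪ ⁅ v ⁆))
    ∎
  where
  open ≡-Reasoning
  c = countV (λ v → not (v ∈ᵇ S) ∧ Q (outside ∷ (S ∪ ⁅ v ⁆)))
  add-zero : ∀ b → (if b then 1 else 0) ℕ.+ c ≡ (if b then suc c else c)
  add-zero true  = refl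
  add-zero false = refl

filterᵇ-cong : ∀ {A : Set} {P Q : A → Bool} → (∀ x → P x ≡ Q x) → ∀ xs → filterᵇ P xs ≡ filterᵇ Q xs
filterᵇ-cong P≗Q []       = refl
filterᵇ-cong {P = P} {Q} P≗Q (x ∷ xs) rewrite P≗Q x with Q x
... | true  = cong (x ∷_) (filterᵇ-cong P≗Q xs)
... | false = filterᵇ-cong P≗Q xs

countV-cong : ∀ {P Q : Fin n → Bool} → (∀ v → P v ≡ Q v) → countV P ≡ countV Q
countV-cong {n} P≗Q = cong length (filterᵇ-cong P≗Q (allFin n))

module _ {n : ℕ} (H : Hypergraph3 n) where

  #K-one-more : ∀ (S : Subset n) →
                #K H (suc ∣ S ∣) S ≡ countV (λ v → not (v ∈ᵇ S) ∧ isClique H (S ∪ ⁅ v ⁆))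
  #K-one-more S = begin
    length (filterᵇ (λ T → isClique H T ∧ (S ⊆ᵇ T)) (filterᵇ size-ok (allSubsets n)))
      ≡⟨ length-filterᵇ-filterᵇ size-ok _ (allSubsets n) ⟩
    length (filterᵇ (λ T → size-ok T ∧ (isClique H T ∧ (S ⊆ᵇ T))) (allSubsets n))
      ≡⟨ length-filterᵇ-allSubsets {n} _ ⟩
    countSubsets (λ T → size-ok T ∧ (isClique H T ∧ (S ⊆ᵇ T)))
      ≡⟨ countSubsets-cong reorder ⟩
    countSubsets (λ T → (S ⊆ᵇ T) ∧ ((∣ T ∣ ≡ᵇ suc ∣ S ∣) ∧ isClique H T))
      ≡⟨ countSubsets-⊇-one-more S (isClique H) ⟩
    countV (λ v → not (v ∈ᵇ S) ∧ isClique H (S ∪ ⁅ v ⁆))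
      ∎
    where
    open ≡-Reasoning
    size-ok : Subset n → Bool
    size-ok T = (∣ T ∣ ≡ᵇ suc ∣ S ∣) ∧ (T ⊆ᵇ ⊤)
    reorder : ∀ T → size-ok T ∧ (isClique H T ∧ (S ⊆ᵇ T)) ≡ (S ⊆ᵇ T) ∧ ((∣ T ∣ ≡ᵇ suc ∣ S ∣) ∧ isClique H T)
    reorder T rewrite ⊆⇒⊆ᵇ {s = T} ⊆⊤ with ∣ T ∣ ≡ᵇ suc ∣ S ∣ | isClique H T | S ⊆ᵇ T
    ... | true  | c | s = ∧-comm c s
    ... | false | c | s = sym (∧-zeroʳ s)

  #K≡countV-CN : ∀ {S : Subset n} → isClique H S ≡ true → 2 ≤ ∣ S ∣ → #K H (suc ∣ S ∣) S ≡ countV (CN H S)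
  #K≡countV-CN {S} S-clique 2≤∣S∣ = trans (#K-one-more S) (countV-cong extends)
    where
    extends : ∀ v → not (v ∈ᵇ S) ∧ isClique H (S ∪ ⁅ v ⁆) ≡ CN H S v
    extends v with v ∈? S
    ... | no v∉S rewrite ∉⇒∈ᵇ≡false v∉S | isClique-∪-CN H v∉S | S-clique = refl
    ... | yes v∈S rewrite ∈⇒∈ᵇ v∈S with CN H S v in v∈CN
    ...   | false = refl
    ...   | true  = ⊥-elim (CN⇒∉ H 2≤∣S∣ v∈CN v∈S)

countV-complement : ∀ (P : Fin n → Bool) → countV (λ v → not (P v)) ℕ.+ countV P ≡ n
countV-complement {zero}  P = refl
countV-complement {suc n} P
  rewrite countV-suc (λ v → not (P v)) | countV-suc P with P zero
... | true  = trans (+-suc _ _) (cong suc (countV-complement (P ∘ suc)))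
... | false = cong suc (countV-complement (P ∘ suc))

countV-∨ : ∀ (P Q : Fin n → Bool) → countV (λ v → P v ∨ Q v) ≤ countV P ℕ.+ countV Q
countV-∨ {zero}  P Q = z≤n
countV-∨ {suc n} P Q
  rewrite countV-suc (λ v → P v ∨ Q v) | countV-suc P | countV-suc Q with P zero | Q zero
... | true  | true  = s≤s (≤-trans (countV-∨ (P ∘ suc) (Q ∘ suc)) (+-monoʳ-≤ _ (n≤1+n _)))
... | true  | false = s≤s (countV-∨ (P ∘ suc) (Q ∘ suc))
... | false | true  = ≤-trans (s≤s (countV-∨ (P ∘ suc) (Q ∘ suc))) (≤-reflexive (sym (+-suc _ _)))
... | false | false = countV-∨ (P ∘ suc) (Q ∘ suc)

countV-none : countV {n} (λ _ → false) ≡ 0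
countV-none {zero}  = refl
countV-none {suc n} = trans (countV-suc {n} (λ _ → false)) (countV-none {n})

countV-pos : ∀ (P : Fin n → Bool) {v} → P v ≡ true → 0 < countV P
countV-pos P {zero}  Pv rewrite countV-suc P | Pv = s≤s z≤n
countV-pos P {suc v} Pv rewrite countV-suc P with P zero
... | true  = s≤s z≤n
... | false = countV-pos (P ∘ suc) Pv

countV-not-all : ∀ {A : Set} (f : A → Fin n → Bool) (ps : List A) →
  countV (λ v → not (all (λ p → f p v) ps)) ≤ sum (map (λ p → countV (λ v → not (f p v))) ps)
countV-not-all {n} f []       = ≤-reflexive (countV-none {n})
countV-not-all {n} f (p ∷ ps) = begin
  countV (λ v → not (f p v ∧ all (λ p → f p v) ps))
    ≡⟨ countV-cong (λ v → not-∧ (f p v)) ⟩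
  countV (λ v → not (f p v) ∨ not (all (λ p → f p v) ps))
    ≤⟨ countV-∨ {n} _ _ ⟩
  countV (λ v → not (f p v)) ℕ.+ countV (λ v → not (all (λ p → f p v) ps))
    ≤⟨ +-monoʳ-≤ _ (countV-not-all f ps) ⟩
  countV (λ v → not (f p v)) ℕ.+ sum (map (λ p → countV (λ v → not (f p v))) ps)
    ∎
  where
  open ≤-Reasoning
  not-∧ : ∀ a {b} → not (a ∧ b) ≡ not a ∨ not b
  not-∧ true  = refl
  not-∧ false = refl

countSubsets-⊆ : ∀ (S : Subset n) k → countSubsets (λ t → (∣ t ∣ ≡ᵇ k) ∧ (t ⊆ᵇ S)) ≡ ∣ S ∣ C k
countSubsets-⊆ []           zero    = refl
countSubsets-⊆ []           (suc k) = refl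
countSubsets-⊆ {suc n} (inside ∷ S) zero =
  trans (cong (ℕ._+ countSubsets {n} (λ t → (∣ t ∣ ≡ᵇ 0) ∧ (t ⊆ᵇ S))) (countSubsets-none {n} _ (λ _ → refl)))
        (countSubsets-⊆ S zero)
countSubsets-⊆ (inside ∷ S) (suc k) =
  trans (cong₂ ℕ._+_ (countSubsets-⊆ S k) (countSubsets-⊆ S (suc k))) (nCk+nC[k+1]≡[n+1]C[k+1] ∣ S ∣ k)
countSubsets-⊆ {suc n} (outside ∷ S) k =
  trans (cong (ℕ._+ countSubsets {n} (λ t → (∣ t ∣ ≡ᵇ k) ∧ (t ⊆ᵇ S)))
              (countSubsets-none {n} _ (λ t → ∧-zeroʳ (suc ∣ t ∣ ≡ᵇ k))))
        (countSubsets-⊆ S k)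

length-subsetsOfSize : ∀ (S : Subset n) k → length (subsetsOfSize k S) ≡ ∣ S ∣ C k
length-subsetsOfSize {n} S k = trans (length-filterᵇ-allSubsets {n} _) (countSubsets-⊆ S k)

module _ {n : ℕ} (k : ℕ) where

  private
    k*sum+length≤length*n : ∀ cs → All (λ c → k ℕ.* c < n) cs → k ℕ.* sum cs ℕ.+ length cs ≤ length cs ℕ.* n
    k*sum+length≤length*n []       []             = ≤-reflexive (cong (ℕ._+ 0) (*-zeroʳ k))
    k*sum+length≤length*n (c ∷ cs) (k*c<n ∷ rest) = begin
      k ℕ.* (c ℕ.+ sum cs) ℕ.+ suc (length cs)        ≡⟨ regroup ⟩
      suc (k ℕ.* c) ℕ.+ (k ℕ.* sum cs ℕ.+ length cs)  ≤⟨ +-mono-≤ k*c<n (k*sum+length≤length*n cs rest) ⟩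
      n ℕ.+ length cs ℕ.* n                           ∎
      where
      open ≤-Reasoning
      regroup : k ℕ.* (c ℕ.+ sum cs) ℕ.+ suc (length cs) ≡ suc (k ℕ.* c) ℕ.+ (k ℕ.* sum cs ℕ.+ length cs)
      regroup = trans (cong (ℕ._+ suc (length cs)) (*-distribˡ-+ k c (sum cs)))
                      (trans (+-suc _ _) (cong suc (+-assoc (k ℕ.* c) _ _)))

  sum<n : ∀ cs → All (λ c → k ℕ.* c < n) cs → length cs ≤ k → 0 < n → sum cs < n
  sum<n []           _    _         0<n = 0<n
  sum<n cs@(_ ∷ _)   k*c<n length≤k _   = *-cancelˡ-< k (sum cs) n (begin-strict
    k ℕ.* sum cs                <⟨ m<m+n (k ℕ.* sum cs) (s≤s z≤n) ⟩
    k ℕ.* sum cs ℕ.+ length cs  ≤⟨ k*sum+length≤length*n cs k*c<n ⟩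
    length cs ℕ.* n             ≤⟨ *-monoˡ-≤ n length≤k ⟩
    k ℕ.* n                     ∎)
    where open ≤-Reasoning

m≤4⇒mC2≤6 : ∀ m → m ≤ 4 → m C 2 ≤ 6
m≤4⇒mC2≤6 0 _ = z≤n
m≤4⇒mC2≤6 1 _ = z≤n
m≤4⇒mC2≤6 2 _ = s≤s z≤n
m≤4⇒mC2≤6 3 _ = s≤s (s≤s (s≤s z≤n))
m≤4⇒mC2≤6 4 _ = ≤-refl
m≤4⇒mC2≤6 (suc (suc (suc (suc (suc m))))) (s≤s (s≤s (s≤s (s≤s ()))))

module _ {n : ℕ} (H : Hypergraph3 n)
         (codegree : ∀ (p : Subset n) → ∣ p ∣ ≡ 2 → 0 < deg H p → 5 ℕ.* n < 6 ℕ.* deg H p) where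

  6*non-neighbours<n : ∀ p → ∣ p ∣ ≡ 2 → 0 < deg H p → 6 ℕ.* countV (λ v → not (Nb H p v)) < n
  6*non-neighbours<n p ∣p∣≡2 0<deg = +-cancelʳ-< (5 ℕ.* n) (6 ℕ.* c) n (begin-strict
    6 ℕ.* c ℕ.+ 5 ℕ.* n        <⟨ +-monoʳ-< (6 ℕ.* c) (codegree p ∣p∣≡2 0<deg) ⟩
    6 ℕ.* c ℕ.+ 6 ℕ.* deg H p  ≡⟨ *-distribˡ-+ 6 c (deg H p) ⟨
    6 ℕ.* (c ℕ.+ deg H p)      ≡⟨ cong (6 ℕ.*_) (countV-complement (Nb H p)) ⟩
    6 ℕ.* n                    ≡⟨ *-distribʳ-+ n 1 5 ⟩
    1 ℕ.* n ℕ.+ 5 ℕ.* n        ≡⟨ cong (ℕ._+ 5 ℕ.* n) (*-identityˡ n) ⟩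
    n ℕ.+ 5 ℕ.* n              ∎)
    where
    open ≤-Reasoning
    c = countV (λ v → not (Nb H p v))

  deg>0 : ∀ {S p} → isClique H S ≡ true → 3 ≤ ∣ S ∣ → p ⊆ S → ∣ p ∣ ≡ 2 → 0 < deg H p
  deg>0 {S} {p} S-clique 3≤∣S∣ p⊆S ∣p∣≡2
    with ∣p∣<∣q∣⇒∃x∈q∖p {p = p} {q = S} (subst (_< ∣ S ∣) (sym ∣p∣≡2) 3≤∣S∣)
  ... | s , s∈S , s∉p = countV-pos (Nb H p) (isClique⁻ H S-clique p∪s⊆S ∣p∪s∣≡3)
    where
    p∪s⊆S : p ∪ ⁅ s ⁆ ⊆ S
    p∪s⊆S x∈ with x∈p∪q⁻ p ⁅ s ⁆ x∈
    ... | inj₁ x∈p = p⊆S x∈p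
    ... | inj₂ x∈s rewrite x∈⁅y⁆⇒x≡y s x∈s = s∈S
    ∣p∪s∣≡3 : ∣ p ∪ ⁅ s ⁆ ∣ ≡ 3
    ∣p∪s∣≡3 = trans (cong ∣_∣ (∪-comm p ⁅ s ⁆)) (trans (∣⁅x⁆∪p∣ s∉p) (cong suc ∣p∣≡2))

  -- Each of the at most six pairs of S misses fewer than n/6 vertices, so some vertex is missed by none.
  CN-nonempty : ∀ {S} → isClique H S ≡ true → 3 ≤ ∣ S ∣ → ∣ S ∣ ≤ 4 → 0 < countV (CN H S)
  CN-nonempty {S} S-clique 3≤∣S∣ ∣S∣≤4 with countV (CN H S) | countV-complement (CN H S)
  ... | suc _ | _ = s≤s z≤n
  ... | zero  | non+0≡n = ⊥-elim (<-irrefl refl (begin-strict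
    n                                                      ≡⟨ trans (sym (+-identityʳ _)) non+0≡n ⟨
    countV (λ v → not (CN H S v))                          ≤⟨ countV-not-all (λ p v → Nb H p v) pairs ⟩
    sum (map (λ p → countV (λ v → not (Nb H p v))) pairs)  <⟨ sum<n 6 _ each (≤-trans length≤ ∣S∣C2≤6) 0<n ⟩
    n                                                      ∎))
    where
    open ≤-Reasoning
    pairs = subsetsOfSize 2 S
    0<n : 0 < n
    0<n = ≤-trans (s≤s z≤n) (≤-trans 3≤∣S∣ (∣p∣≤n S))
    ∣S∣C2≤6 : ∣ S ∣ C 2 ≤ 6
    ∣S∣C2≤6 = m≤4⇒mC2≤6 ∣ S ∣ ∣S∣≤4
    length≤ : length (map (λ p → countV (λ v → not (Nb H p v))) pairs) ≤ ∣ S ∣ C 2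
    length≤ = ≤-reflexive (trans (length-map _ pairs) (length-subsetsOfSize S 2))
    each : All (λ c → 6 ℕ.* c < n) (map (λ p → countV (λ v → not (Nb H p v))) pairs)
    each = All.map⁺ (All.tabulate λ {p} p∈pairs →
      let ∣p∣≡2 , p⊆S = ∈-subsetsOfSize⁻ p∈pairs
      in 6*non-neighbours<n p ∣p∣≡2 (deg>0 S-clique 3≤∣S∣ p⊆S ∣p∣≡2))

-- Ordered 5-cliques and their weights

map-lookup-allFin : ∀ (w : Vec (Fin n) m) → map (lookup w) (allFin m) ≡ toList w
map-lookup-allFin []              = refl
map-lookup-allFin {m = suc m} (x ∷ w) = cong (x ∷_)
  (trans (map-tabulate suc (lookup (x ∷ w))) (trans (sym (map-tabulate id (lookup w))) (map-lookup-allFin w)))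

toList-insertAt-↭ : ∀ {A : Set} (w : Vec A m) i a → toList (insertAt w i a) ↭ a ∷ toList w
toList-insertAt-↭ w       zero    a = ↭-refl
toList-insertAt-↭ (x ∷ w) (suc i) a = ↭-trans (prep x (toList-insertAt-↭ w i a)) (swap x a ↭-refl)

lookup-injective⇒Unique : ∀ (w : Vec (Fin n) m) → Injective _≡_ _≡_ (lookup w) → Unique (toList w)
lookup-injective⇒Unique []      _   = []
lookup-injective⇒Unique (x ∷ w) inj =
  subst (All (x ≢_)) (map-lookup-allFin w) (All.map⁺ (All.tabulate⁺ (λ j x≡wj → 0≢suc (inj x≡wj))))
  ∷ lookup-injective⇒Unique w (λ e → Data.Fin.Properties.suc-injective (inj e))
  where
  0≢suc : ∀ {j : Fin m} → zero ≢ suc j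
  0≢suc ()

Unique⇒lookup-injective : ∀ (w : Vec (Fin n) m) → Unique (toList w) → Injective _≡_ _≡_ (lookup w)
Unique⇒lookup-injective (x ∷ w) (x∉w ∷ uniq) {zero}  {zero}  _ = refl
Unique⇒lookup-injective (x ∷ w) (x∉w ∷ uniq) {zero}  {suc j} e =
  ⊥-elim (All.lookup x∉w (Vec.∈-toList⁺ (Vec.∈-lookup j w)) e)
Unique⇒lookup-injective (x ∷ w) (x∉w ∷ uniq) {suc i} {zero}  e =
  ⊥-elim (All.lookup x∉w (Vec.∈-toList⁺ (Vec.∈-lookup i w)) (sym e))
Unique⇒lookup-injective (x ∷ w) (x∉w ∷ uniq) {suc i} {suc j} e =
  cong suc (Unique⇒lookup-injective w uniq e)

ψ₀ : Bool → Bool → ℚ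
ψ₀ true  true  = ⅓
ψ₀ false false = ⅓
ψ₀ true  false = -⅙
ψ₀ false true  = -⅙

module _ (H : Hypergraph3 n) where

  private
    distinct-row : (Fin 5 → Fin n) → Fin 5 → Fin 5 → Bool
    distinct-row v i j = does (i ≟ j) ∨ not (does (v i ≟ v j))

  distinctB⇒injective : ∀ {v} → distinctB H v ≡ true → Injective _≡_ _≡_ v
  distinctB⇒injective {v} distinct {i} {j} vi≡vj = distinct-at (all≡true⁻ (distinct-row v i) {allFin 5}
    (all≡true⁻ (λ i → all (distinct-row v i) (allFin 5)) {allFin 5} distinct (∈-allFin i)) (∈-allFin j))
    where
    distinct-at : distinct-row v i j ≡ true → i ≡ j
    distinct-at row with i ≟ j | v i ≟ v j
    ... | yes i≡j | _         = i≡j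
    ... | no  _   | no  vi≢vj = ⊥-elim (vi≢vj vi≡vj)
    distinct-at () | no _ | yes _

  injective⇒distinctB : ∀ {v} → Injective _≡_ _≡_ v → distinctB H v ≡ true
  injective⇒distinctB {v} inj =
    all≡true⁺ (λ i → all (distinct-row v i) (allFin 5)) (allFin 5)
      (λ {i} _ → all≡true⁺ (distinct-row v i) (allFin 5) (λ {j} _ → distinct-at i j))
    where
    distinct-at : ∀ i j → distinct-row v i j ≡ true
    distinct-at i j with i ≟ j
    ... | yes _   = refl
    ... | no  i≢j with v i ≟ v j
    ...   | yes vi≡vj = ⊥-elim (i≢j (inj vi≡vj))
    ...   | no  _     = refl

  vset5-cong : ∀ {v v′ : Fin 5 → Fin n} → (∀ i → v i ≡ v′ i) → vset5 H v ≡ vset5 H v′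
  vset5-cong v≗v′ = cong setOf (map-cong v≗v′ (allFin 5))

  isOrdered5Clique-cong : ∀ {v v′ : Fin 5 → Fin n} → (∀ i → v i ≡ v′ i) →
                          isOrdered5Clique H v ≡ isOrdered5Clique H v′
  isOrdered5Clique-cong v≗v′ =
    cong₂ _∧_ (⇔→≡ {z = true} (mk⇔ (transport v≗v′) (transport (sym ∘ v≗v′))))
              (cong (isClique H) (vset5-cong v≗v′))
    where
    transport : ∀ {u u′ : Fin 5 → Fin n} → (∀ i → u i ≡ u′ i) → distinctB H u ≡ true → distinctB H u′ ≡ true
    transport u≗u′ distinct = injective⇒distinctB (λ {i} {j} e →
      distinctB⇒injective distinct (trans (u≗u′ i) (trans e (sym (u≗u′ j)))))

  ψ-char : ∀ v e → ψ H v e ≡ (if e ⊆ᵇ vset5 H v then ψ₀ (v zero ∈ᵇ e) (v (suc zero) ∈ᵇ e) else 0ℚ)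
  ψ-char v e with e ⊆ᵇ vset5 H v
  ... | false = refl
  ... | true with v zero ∈ᵇ e | v (suc zero) ∈ᵇ e
  ...   | true  | true  = refl
  ...   | true  | false = refl
  ...   | false | true  = refl
  ...   | false | false = refl

  ψ-cong : ∀ {v v′ : Fin 5 → Fin n} → (∀ i → v i ≡ v′ i) → ∀ e → ψ H v e ≡ ψ H v′ e
  ψ-cong {v} {v′} v≗v′ e = begin
    ψ H v e
      ≡⟨ ψ-char v e ⟩
    (if e ⊆ᵇ vset5 H v then ψ₀ (v zero ∈ᵇ e) (v (suc zero) ∈ᵇ e) else 0ℚ)
      ≡⟨ cong (λ S → if e ⊆ᵇ S then ψ₀ (v zero ∈ᵇ e) (v (suc zero) ∈ᵇ e) else 0ℚ) (vset5-cong v≗v′) ⟩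
    (if e ⊆ᵇ vset5 H v′ then ψ₀ (v zero ∈ᵇ e) (v (suc zero) ∈ᵇ e) else 0ℚ)
      ≡⟨ cong₂ (λ a b → if e ⊆ᵇ vset5 H v′ then ψ₀ (a ∈ᵇ e) (b ∈ᵇ e) else 0ℚ) (v≗v′ zero) (v≗v′ (suc zero)) ⟩
    (if e ⊆ᵇ vset5 H v′ then ψ₀ (v′ zero ∈ᵇ e) (v′ (suc zero) ∈ᵇ e) else 0ℚ)
      ≡⟨ ψ-char v′ e ⟨
    ψ H v′ e
      ∎
    where open ≡-Reasoning

  W-swap : ∀ a b cs → W H (a ∷ b ∷ cs) ≡ W H (b ∷ a ∷ cs)
  W-swap a b cs = cong prodℚ (map-cong prefix-set≡ (upTo (suc (length cs))))
    where
    prefix-set≡ : ∀ j → inv (#K H (3 ℕ.+ j) (setOf (a ∷ b ∷ take j cs)))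
                      ≡ inv (#K H (3 ℕ.+ j) (setOf (b ∷ a ∷ take j cs)))
    prefix-set≡ j = cong (λ S → inv (#K H (3 ℕ.+ j) S)) (setOf-↭ (swap a b (↭-refl {x = take j cs})))

  W₃-peel : ∀ a b c → W H (a ∷ b ∷ c ∷ []) ≡ W H (a ∷ b ∷ []) * inv (#K H 4 (setOf (a ∷ b ∷ c ∷ [])))
  W₃-peel a b c = solve 2 (λ p q → p :* (q :* con 1ℚ) := (p :* con 1ℚ) :* q) refl
    (inv (#K H 3 (setOf (a ∷ b ∷ [])))) (inv (#K H 4 (setOf (a ∷ b ∷ c ∷ []))))

  W₄-peel : ∀ a b c d →
            W H (a ∷ b ∷ c ∷ d ∷ []) ≡ W H (a ∷ b ∷ c ∷ []) * inv (#K H 5 (setOf (a ∷ b ∷ c ∷ d ∷ [])))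
  W₄-peel a b c d = solve 3 (λ p q r → p :* (q :* (r :* con 1ℚ)) := (p :* (q :* con 1ℚ)) :* r) refl
    (inv (#K H 3 (setOf (a ∷ b ∷ [])))) (inv (#K H 4 (setOf (a ∷ b ∷ c ∷ []))))
    (inv (#K H 5 (setOf (a ∷ b ∷ c ∷ d ∷ []))))

-- (i , j , k) stands for the 5-tuple obtained from (y , z) by inserting x₃ at position k, then
-- x₂ at position j and then x₁ at position i: the ten ways for x₁, x₂, x₃ to occur in this order.
Pattern : Set
Pattern = Fin 5 × Fin 4 × Fin 3

patterns : List Pattern
patterns = (0F , 0F , 0F) ∷ (0F , 0F , 1F) ∷ (0F , 0F , 2F) ∷ (0F , 1F , 1F) ∷ (0F , 1F , 2F)
         ∷ (0F , 2F , 2F) ∷ (1F , 1F , 1F) ∷ (1F , 1F , 2F) ∷ (1F , 2F , 2F) ∷ (2F , 2F , 2F) ∷ []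

Unique-patterns : Unique patterns
Unique-patterns = from-yes (unique? (×-≡-dec _≟_ (×-≡-dec _≟_ _≟_)) patterns)

module _ (H : Hypergraph3 n) (x₁ x₂ x₃ : Fin n) where

  fill : Pattern → Vec (Fin n) 2 → Vec (Fin n) 5
  fill (i , j , k) w = insertAt (insertAt (insertAt w k x₃) j x₂) i x₁

  matches : (Fin 5 → Fin n) → Pattern → Bool
  matches v (i , j , k) =
    does (v i ≟ x₁) ∧ (does (v (punchIn i j) ≟ x₂) ∧ does (v (punchIn i (punchIn j k)) ≟ x₃))

  -- Both sides are the disjunction over the ten increasing position triples, bracketed differently.
  subseqB≡any-matches : ∀ v → subseqB H x₁ x₂ x₃ v ≡ any (matches v) patterns
  subseqB≡any-matches v = ∨-solve 10
    (λ m₀₁₂ m₀₁₃ m₀₁₄ m₀₂₃ m₀₂₄ m₀₃₄ m₁₂₃ m₁₂₄ m₁₃₄ m₂₃₄ →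
       ((m₀₁₂ ⊕ m₀₁₃ ⊕ m₀₁₄ ⊕ ε) ⊕ (m₀₂₃ ⊕ m₀₂₄ ⊕ ε) ⊕ (m₀₃₄ ⊕ ε) ⊕ ε)
       ⊕ ((m₁₂₃ ⊕ m₁₂₄ ⊕ ε) ⊕ (m₁₃₄ ⊕ ε) ⊕ ε) ⊕ ((m₂₃₄ ⊕ ε) ⊕ ε) ⊕ ε
     ⊜ m₀₁₂ ⊕ m₀₁₃ ⊕ m₀₁₄ ⊕ m₀₂₃ ⊕ m₀₂₄ ⊕ m₀₃₄ ⊕ m₁₂₃ ⊕ m₁₂₄ ⊕ m₁₃₄ ⊕ m₂₃₄ ⊕ ε)
    refl (at 0F 1F 2F) (at 0F 1F 3F) (at 0F 1F 4F) (at 0F 2F 3F) (at 0F 2F 4F)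
         (at 0F 3F 4F) (at 1F 2F 3F) (at 1F 2F 4F) (at 1F 3F 4F) (at 2F 3F 4F)
    where
    at : Fin 5 → Fin 5 → Fin 5 → Bool
    at i j k = does (v i ≟ x₁) ∧ (does (v j ≟ x₂) ∧ does (v k ≟ x₃))

  subseqB-cong : ∀ {v v′ : Fin 5 → Fin n} → (∀ i → v i ≡ v′ i) → subseqB H x₁ x₂ x₃ v ≡ subseqB H x₁ x₂ x₃ v′
  subseqB-cong {v} {v′} v≗v′ = begin
    subseqB H x₁ x₂ x₃ v         ≡⟨ subseqB≡any-matches v ⟩
    any (matches v) patterns     ≡⟨ cong or (map-cong matches≗ patterns) ⟩
    any (matches v′) patterns    ≡⟨ subseqB≡any-matches v′ ⟨
    subseqB H x₁ x₂ x₃ v′        ∎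
    where
    open ≡-Reasoning
    at≗ : ∀ x i → does (v i ≟ x) ≡ does (v′ i ≟ x)
    at≗ x i = cong (λ a → does (a ≟ x)) (v≗v′ i)
    matches≗ : ∀ p → matches v p ≡ matches v′ p
    matches≗ (i , j , k) =
      cong₂ _∧_ (at≗ x₁ i) (cong₂ _∧_ (at≗ x₂ (punchIn i j)) (at≗ x₃ (punchIn i (punchIn j k))))

  private
    ≟-true⇒≡ : ∀ {a b : Fin n} → does (a ≟ b) ≡ true → a ≡ b
    ≟-true⇒≡ {a} {b} h with a ≟ b
    ... | yes a≡b = a≡b

    matches⇒ : ∀ {v} i j k → matches v (i , j , k) ≡ true →
               v i ≡ x₁ × v (punchIn i j) ≡ x₂ × v (punchIn i (punchIn j k)) ≡ x₃
    matches⇒ {v} i j k m =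
      let m₁ , m₂₃ = ∧≡true⁻ m
          m₂ , m₃  = ∧≡true⁻ {does (v (punchIn i j) ≟ x₂)} m₂₃
      in ≟-true⇒≡ m₁ , ≟-true⇒≡ m₂ , ≟-true⇒≡ m₃

  matches-unique : ∀ {v} → Injective _≡_ _≡_ v → ∀ {p q} → matches v p ≡ true → matches v q ≡ true → p ≡ q
  matches-unique {v} inj {i , j , k} {i′ , j′ , k′} m m′
    with matches⇒ {v} i j k m | matches⇒ {v} i′ j′ k′ m′
  ... | v₁ , v₂ , v₃ | v₁′ , v₂′ , v₃′ with inj {i} {i′} (trans v₁ (sym v₁′))
  ... | refl with punchIn-injective i j j′ (inj (trans v₂ (sym v₂′)))
  ... | refl with punchIn-injective j k k′
                    (punchIn-injective i (punchIn j k) (punchIn j k′) (inj (trans v₃ (sym v₃′))))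
  ... | refl = refl

  ΣVⁿ-matches : ∀ p (F : Vec (Fin n) 5 → ℚ) →
                ΣVⁿ 5 (λ w → if matches (lookup w) p then F w else 0ℚ) ≡ ΣVⁿ 2 (F ∘ fill p)
  ΣVⁿ-matches (i , j , k) F = begin
    ΣVⁿ 5 (λ w → if matches (lookup w) (i , j , k) then F w else 0ℚ)
      ≡⟨ ΣVⁿ-cong 5 (λ w → if-∧ (does (lookup w i ≟ x₁)) (does (lookup w (punchIn i j) ≟ x₂))
                                 (does (lookup w (punchIn i (punchIn j k)) ≟ x₃)) (F w)) ⟩
    ΣVⁿ 5 (λ w → if does (lookup w i ≟ x₁) then if₂ w else 0ℚ)
      ≡⟨ ΣVⁿ-δ i x₁ if₂ ⟩
    ΣVⁿ 4 (λ w → if₂ (insertAt w i x₁))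
      ≡⟨ ΣVⁿ-cong 4 (λ w → cong₂ (λ a b → if does (a ≟ x₂) then if does (b ≟ x₃) then F (insertAt w i x₁) else 0ℚ
                                                             else 0ℚ)
                                  (insertAt-punchIn w i x₁ j) (insertAt-punchIn w i x₁ (punchIn j k))) ⟩
    ΣVⁿ 4 (λ w → if does (lookup w j ≟ x₂) then if₃ w else 0ℚ)
      ≡⟨ ΣVⁿ-δ j x₂ if₃ ⟩
    ΣVⁿ 3 (λ w → if₃ (insertAt w j x₂))
      ≡⟨ ΣVⁿ-cong 3 (λ w → cong (λ a → if does (a ≟ x₃) then F (insertAt (insertAt w j x₂) i x₁) else 0ℚ)
                               (insertAt-punchIn w j x₂ k)) ⟩
    ΣVⁿ 3 (λ w → if does (lookup w k ≟ x₃) then F (insertAt (insertAt w j x₂) i x₁) else 0ℚ)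
      ≡⟨ ΣVⁿ-δ k x₃ (λ w → F (insertAt (insertAt w j x₂) i x₁)) ⟩
    ΣVⁿ 2 (F ∘ fill (i , j , k))
      ∎
    where
    open ≡-Reasoning
    if₂ : Vec (Fin n) 5 → ℚ
    if₂ w = if does (lookup w (punchIn i j) ≟ x₂)
              then if does (lookup w (punchIn i (punchIn j k)) ≟ x₃) then F w else 0ℚ
              else 0ℚ
    if₃ : Vec (Fin n) 4 → ℚ
    if₃ w = if does (lookup w (punchIn j k) ≟ x₃) then F (insertAt w i x₁) else 0ℚ
    if-∧ : ∀ a b c (q : ℚ) →
           (if a ∧ (b ∧ c) then q else 0ℚ) ≡ (if a then (if b then (if c then q else 0ℚ) else 0ℚ) else 0ℚ)
    if-∧ true  true  c q = refl
    if-∧ true  false c q = refl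
    if-∧ false b     c q = refl

-- A fixed ordered edge (x₁, x₂, x₃)

module OrderedEdge {n : ℕ} (H : Hypergraph3 n)
         (codegree : ∀ (p : Subset n) → ∣ p ∣ ≡ 2 → 0 < deg H p → 5 ℕ.* n < 6 ℕ.* deg H p)
         (x₁ x₂ x₃ : Fin n) (x₁≢x₂ : x₁ ≢ x₂) (x₁≢x₃ : x₁ ≢ x₃) (x₂≢x₃ : x₂ ≢ x₃)
         (edge : E H (setOf (x₁ ∷ x₂ ∷ x₃ ∷ [])) ≡ true) where

  xs : List (Fin n)
  xs = x₁ ∷ x₂ ∷ x₃ ∷ []

  X : Subset n
  X = setOf xs

  X⁺ : Fin n → Subset n
  X⁺ y = setOf (xs ∷ʳ y)

  xs-unique : Unique xs
  xs-unique = (x₁≢x₂ ∷ x₁≢x₃ ∷ []) ∷ (x₂≢x₃ ∷ []) ∷ [] ∷ []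

  ∣X∣≡3 : ∣ X ∣ ≡ 3
  ∣X∣≡3 = ∣setOf∣ xs-unique

  X-clique : isClique H X ≡ true
  X-clique = isClique⁺ H λ t⊆X ∣t∣≡3 →
    subst (λ t → E H t ≡ true) (sym (p⊆q∧∣q∣≤∣p∣⇒p≡q t⊆X (≤-reflexive (trans ∣X∣≡3 (sym ∣t∣≡3))))) edge

  X⁺≡X∪y : ∀ y → X⁺ y ≡ X ∪ ⁅ y ⁆
  X⁺≡X∪y = setOf-∷ʳ xs

  y∷xs≡X⁺ : ∀ y → setOf (y ∷ xs) ≡ X⁺ y
  y∷xs≡X⁺ y = setOf-↭ (∷↭∷ʳ y xs)

  y∉X : ∀ {y} → CN H X y ≡ true → y ∉ X
  y∉X = CN⇒∉ H (subst (2 ≤_) (sym ∣X∣≡3) (s≤s (s≤s z≤n)))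

  ∣X⁺∣≡4 : ∀ {y} → CN H X y ≡ true → ∣ X⁺ y ∣ ≡ 4
  ∣X⁺∣≡4 {y} y∈CN = begin
    ∣ X⁺ y ∣       ≡⟨ cong ∣_∣ (trans (X⁺≡X∪y y) (∪-comm X ⁅ y ⁆)) ⟩
    ∣ ⁅ y ⁆ ∪ X ∣  ≡⟨ ∣⁅x⁆∪p∣ (y∉X y∈CN) ⟩
    suc ∣ X ∣      ≡⟨ cong suc ∣X∣≡3 ⟩
    4              ∎
    where open ≡-Reasoning

  X⁺-clique : ∀ {y} → CN H X y ≡ true → isClique H (X⁺ y) ≡ true
  X⁺-clique {y} y∈CN = begin
    isClique H (X⁺ y)        ≡⟨ cong (isClique H) (X⁺≡X∪y y) ⟩
    isClique H (X ∪ ⁅ y ⁆)   ≡⟨ isClique-∪-CN H (y∉X y∈CN) ⟩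
    isClique H X ∧ CN H X y  ≡⟨ cong₂ _∧_ X-clique y∈CN ⟩
    true                     ∎
    where open ≡-Reasoning

  z∉X⁺ : ∀ {y z} → CN H X y ≡ true → CN H (X⁺ y) z ≡ true → z ∉ X⁺ y
  z∉X⁺ y∈CN = CN⇒∉ H (subst (2 ≤_) (sym (∣X⁺∣≡4 y∈CN)) (s≤s (s≤s z≤n)))

  x₁∈ᵇX : x₁ ∈ᵇ X ≡ true
  x₁∈ᵇX = ∈⇒∈ᵇ {s = X} (∈-setOf⁺ {xs = xs} (here refl))

  x₂∈ᵇX : x₂ ∈ᵇ X ≡ true
  x₂∈ᵇX = ∈⇒∈ᵇ {s = X} (∈-setOf⁺ {xs = xs} (there (here refl)))

  y∉ᵇX : ∀ {y} → CN H X y ≡ true → y ∈ᵇ X ≡ false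
  y∉ᵇX y∈CN = ∉⇒∈ᵇ≡false (y∉X y∈CN)

  z∉ᵇX : ∀ {y z} → CN H X y ≡ true → CN H (X⁺ y) z ≡ true → z ∈ᵇ X ≡ false
  z∉ᵇX {y} y∈CN z∈CN =
    ∉⇒∈ᵇ≡false (λ z∈X → z∉X⁺ y∈CN z∈CN (subst (_ ∈_) (sym (X⁺≡X∪y y)) (p⊆p∪q ⁅ y ⁆ z∈X)))

  #K₄≡ : #K H 4 X ≡ countV (CN H X)
  #K₄≡ = subst (λ k → #K H (suc k) X ≡ countV (CN H X)) ∣X∣≡3
               (#K≡countV-CN H X-clique (subst (2 ≤_) (sym ∣X∣≡3) (s≤s (s≤s z≤n))))

  #K₅≡ : ∀ {y} → CN H X y ≡ true → #K H 5 (X⁺ y) ≡ countV (CN H (X⁺ y))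
  #K₅≡ {y} y∈CN = subst (λ k → #K H (suc k) (X⁺ y) ≡ countV (CN H (X⁺ y))) (∣X⁺∣≡4 y∈CN)
    (#K≡countV-CN H (X⁺-clique y∈CN) (subst (2 ≤_) (sym (∣X⁺∣≡4 y∈CN)) (s≤s (s≤s z≤n))))

  CN-X-nonempty : 0 < countV (CN H X)
  CN-X-nonempty = CN-nonempty H codegree X-clique
    (≤-reflexive (sym ∣X∣≡3)) (subst (_≤ 4) (sym ∣X∣≡3) (s≤s (s≤s (s≤s z≤n))))

  CN-X⁺-nonempty : ∀ {y} → CN H X y ≡ true → 0 < countV (CN H (X⁺ y))
  CN-X⁺-nonempty y∈CN = CN-nonempty H codegree (X⁺-clique y∈CN)
    (subst (3 ≤_) (sym (∣X⁺∣≡4 y∈CN)) (s≤s (s≤s (s≤s z≤n)))) (≤-reflexive (∣X⁺∣≡4 y∈CN))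

  Σz-cancel : ∀ {y} → CN H X y ≡ true → ∀ a b c d → setOf (a ∷ b ∷ c ∷ d ∷ []) ≡ X⁺ y →
              ΣV[ CN H (X⁺ y) ] (λ _ → W H (a ∷ b ∷ c ∷ d ∷ [])) ≡ W H (a ∷ b ∷ c ∷ [])
  Σz-cancel {y} y∈CN a b c d abcd≡X⁺ = begin
    ΣV[ CN H (X⁺ y) ] (λ _ → W H (a ∷ b ∷ c ∷ d ∷ []))
      ≡⟨ cong (λ w → ΣV[ CN H (X⁺ y) ] (λ _ → w)) (W₄-peel H a b c d) ⟩
    ΣV[ CN H (X⁺ y) ] (λ _ → W H (a ∷ b ∷ c ∷ []) * inv (#K H 5 (setOf (a ∷ b ∷ c ∷ d ∷ []))))
      ≡⟨ cong (λ k → ΣV[ CN H (X⁺ y) ] (λ _ → W H (a ∷ b ∷ c ∷ []) * inv k))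
              (trans (cong (#K H 5) abcd≡X⁺) (#K₅≡ y∈CN)) ⟩
    ΣV[ CN H (X⁺ y) ] (λ _ → W H (a ∷ b ∷ c ∷ []) * inv (countV (CN H (X⁺ y))))
      ≡⟨ ΣV[]-cancel (CN H (X⁺ y)) _ (CN-X⁺-nonempty y∈CN) ⟩
    W H (a ∷ b ∷ c ∷ [])
      ∎
    where open ≡-Reasoning

  Σy-cancel : ΣV[ CN H X ] (λ _ → W H (x₁ ∷ x₂ ∷ x₃ ∷ [])) ≡ W H (x₁ ∷ x₂ ∷ [])
  Σy-cancel = begin
    ΣV[ CN H X ] (λ _ → W H (x₁ ∷ x₂ ∷ x₃ ∷ []))
      ≡⟨ cong (λ w → ΣV[ CN H X ] (λ _ → w)) (W₃-peel H x₁ x₂ x₃) ⟩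
    ΣV[ CN H X ] (λ _ → W H (x₁ ∷ x₂ ∷ []) * inv (#K H 4 X))
      ≡⟨ cong (λ k → ΣV[ CN H X ] (λ _ → W H (x₁ ∷ x₂ ∷ []) * inv k)) #K₄≡ ⟩
    ΣV[ CN H X ] (λ _ → W H (x₁ ∷ x₂ ∷ []) * inv (countV (CN H X)))
      ≡⟨ ΣV[]-cancel (CN H X) _ CN-X-nonempty ⟩
    W H (x₁ ∷ x₂ ∷ [])
      ∎
    where open ≡-Reasoning

  module _ (y z : Fin n) where

    fill-↭ : ∀ p → toList (fill H x₁ x₂ x₃ p (y ∷ z ∷ [])) ↭ z ∷ y ∷ xs
    fill-↭ (i , j , k) =
      ↭-trans (↭-trans (toList-insertAt-↭ _ i x₁) (prep x₁ (↭-trans (toList-insertAt-↭ _ j x₂)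
                                                                (prep x₂ (toList-insertAt-↭ (y ∷ z ∷ []) k x₃)))))
              (↭-trans (shifts xs (y ∷ z ∷ [])) (swap y z ↭-refl))

    vset5-fill : ∀ p → vset5 H (lookup (fill H x₁ x₂ x₃ p (y ∷ z ∷ []))) ≡ setOf (z ∷ y ∷ xs)
    vset5-fill p = trans (cong setOf (map-lookup-allFin (fill H x₁ x₂ x₃ p (y ∷ z ∷ [])))) (setOf-↭ (fill-↭ p))

    distinctB-fill : ∀ p → distinctB H (lookup (fill H x₁ x₂ x₃ p (y ∷ z ∷ []))) ≡ true ⇔ Unique (z ∷ y ∷ xs)
    distinctB-fill p = mk⇔
      (λ distinct → Unique-resp-↭ (setoid (Fin n)) (↭⇒↭ₛ (fill-↭ p))
                      (lookup-injective⇒Unique w (distinctB⇒injective H distinct)))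
      (λ unique → injective⇒distinctB H
                    (Unique⇒lookup-injective w (Unique-resp-↭ (setoid (Fin n)) (↭⇒↭ₛ (↭-sym (fill-↭ p))) unique)))
      where w = fill H x₁ x₂ x₃ p (y ∷ z ∷ [])

    Unique⇔∉ : Unique (z ∷ y ∷ xs) ⇔ (y ∉ X × z ∉ setOf (y ∷ xs))
    Unique⇔∉ = mk⇔ (λ { (z≢ ∷ y≢ ∷ _) → All≢⇒∉setOf y≢ , All≢⇒∉setOf z≢ })
                   (λ (y∉ , z∉) → ∉setOf⇒All≢ z∉ ∷ ∉setOf⇒All≢ y∉ ∷ xs-unique)

    isClique-z∷y∷xs : y ∉ X → z ∉ setOf (y ∷ xs) → isClique H (setOf (z ∷ y ∷ xs)) ≡ CN H X y ∧ CN H (X⁺ y) z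
    isClique-z∷y∷xs y∉X z∉y∷xs = begin
      isClique H (⁅ z ⁆ ∪ setOf (y ∷ xs))
        ≡⟨ cong (isClique H) (∪-comm ⁅ z ⁆ _) ⟩
      isClique H (setOf (y ∷ xs) ∪ ⁅ z ⁆)
        ≡⟨ isClique-∪-CN H z∉y∷xs ⟩
      isClique H (⁅ y ⁆ ∪ X) ∧ CN H (setOf (y ∷ xs)) z
        ≡⟨ cong₂ _∧_ (cong (isClique H) (∪-comm ⁅ y ⁆ X)) (cong (λ S → CN H S z) (y∷xs≡X⁺ y)) ⟩
      isClique H (X ∪ ⁅ y ⁆) ∧ CN H (X⁺ y) z
        ≡⟨ cong (_∧ CN H (X⁺ y) z) (isClique-∪-CN H y∉X) ⟩
      (isClique H X ∧ CN H X y) ∧ CN H (X⁺ y) z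
        ≡⟨ cong (λ b → (b ∧ CN H X y) ∧ CN H (X⁺ y) z) X-clique ⟩
      CN H X y ∧ CN H (X⁺ y) z
        ∎
      where open ≡-Reasoning

    isOrdered5Clique-fill : ∀ p →
      isOrdered5Clique H (lookup (fill H x₁ x₂ x₃ p (y ∷ z ∷ []))) ≡ CN H X y ∧ CN H (X⁺ y) z
    isOrdered5Clique-fill p = ⇔→≡ {z = true} (mk⇔ to from)
      where
      w = fill H x₁ x₂ x₃ p (y ∷ z ∷ [])
      to : isOrdered5Clique H (lookup w) ≡ true → CN H X y ∧ CN H (X⁺ y) z ≡ true
      to ok = let distinct , clique = ∧≡true⁻ ok
                  y∉X , z∉ = Equivalence.to Unique⇔∉ (Equivalence.to (distinctB-fill p) distinct)
              in trans (sym (isClique-z∷y∷xs y∉X z∉)) (trans (cong (isClique H) (sym (vset5-fill p))) clique)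
      from : CN H X y ∧ CN H (X⁺ y) z ≡ true → isOrdered5Clique H (lookup w) ≡ true
      from cn = let y∈CN , z∈CN = ∧≡true⁻ cn
                    z∉ = subst (z ∉_) (sym (y∷xs≡X⁺ y)) (z∉X⁺ y∈CN z∈CN)
                in cong₂ _∧_ (Equivalence.from (distinctB-fill p) (Equivalence.from Unique⇔∉ (y∉X y∈CN , z∉)))
                             (trans (cong (isClique H) (vset5-fill p)) (trans (isClique-z∷y∷xs (y∉X y∈CN) z∉) cn))

    ψ-fill : ∀ p → let v = lookup (fill H x₁ x₂ x₃ p (y ∷ z ∷ [])) in ψ H v X ≡ ψ₀ (v 0F ∈ᵇ X) (v 1F ∈ᵇ X)
    ψ-fill p = trans (ψ-char H v X) (cong (λ b → if b then ψ₀ (v 0F ∈ᵇ X) (v 1F ∈ᵇ X) else 0ℚ) X⊆vset5)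
      where
      v = lookup (fill H x₁ x₂ x₃ p (y ∷ z ∷ []))
      X⊆vset5 : X ⊆ᵇ vset5 H v ≡ true
      X⊆vset5 = trans (cong (X ⊆ᵇ_) (vset5-fill p))
                      (⊆⇒⊆ᵇ {s = X} {t = setOf (z ∷ y ∷ xs)} (λ x∈X → x∈p∪q⁺ (inj₂ (x∈p∪q⁺ (inj₂ x∈X)))))

  prefix : (Fin 5 → Fin n) → List (Fin n)
  prefix v = v 0F ∷ v 1F ∷ v 2F ∷ v 3F ∷ []

  summand : (Fin 5 → Fin n) → ℚ
  summand v = if isOrdered5Clique H v ∧ subseqB H x₁ x₂ x₃ v then W H (prefix v) * ψ H v X else 0ℚ

  cliqueTerm : (Fin 5 → Fin n) → ℚ
  cliqueTerm v = if isOrdered5Clique H v then W H (prefix v) * ψ H v X else 0ℚ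

  summand-by-patterns : ∀ v →
    summand v ≡ sumℚ (map (λ p → if matches H x₁ x₂ x₃ v p then cliqueTerm v else 0ℚ) patterns)
  summand-by-patterns v with isOrdered5Clique H v in ok
  ... | false = sym (sumℚ-zero _ patterns (λ {p} _ → if-same (matches H x₁ x₂ x₃ v p)))
    where
    if-same : ∀ b → (if b then 0ℚ else 0ℚ) ≡ 0ℚ
    if-same true  = refl
    if-same false = refl
  ... | true = trans (cong (λ b → if b then W H (prefix v) * ψ H v X else 0ℚ) (subseqB≡any-matches H x₁ x₂ x₃ v))
                     (if-any≡sum (matches H x₁ x₂ x₃ v) Unique-patterns
                        (matches-unique H x₁ x₂ x₃ {v} (distinctB⇒injective H (proj₁ (∧≡true⁻ ok)))) _)

  summand-cong : ∀ {v v′} → (∀ i → v i ≡ v′ i) → summand v ≡ summand v′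
  summand-cong v≗v′ =
    cong₂ (λ b q → if b then q else 0ℚ)
          (cong₂ _∧_ (isOrdered5Clique-cong H v≗v′) (subseqB-cong H x₁ x₂ x₃ v≗v′))
          (cong₂ _*_ (cong (W H) prefix≡) (ψ-cong H v≗v′ X))
    where
    prefix≡ = cong₂ _∷_ (v≗v′ 0F) (cong₂ _∷_ (v≗v′ 1F) (cong₂ _∷_ (v≗v′ 2F) (cong (_∷ []) (v≗v′ 3F))))

  -- wH sums over a tuple function local to its definition; unification supplies it for t below.
  ΣV⁵-tuple : (t : Fin n → Fin n → Fin n → Fin n → Fin n → Fin 5 → Fin n) →
              (∀ a b c d e i → t a b c d e i ≡ lookup (a ∷ b ∷ c ∷ d ∷ e ∷ []) i) →
              ΣV (λ a → ΣV (λ b → ΣV (λ c → ΣV (λ d → ΣV (λ e → summand (t a b c d e))))))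
              ≡ ΣVⁿ 5 (summand ∘ lookup)
  ΣV⁵-tuple t t≗ = ΣV-cong λ a → ΣV-cong λ b → ΣV-cong λ c → ΣV-cong λ d → ΣV-cong λ e →
    summand-cong (t≗ a b c d e)

  wH≡ΣVⁿ : wH H x₁ x₂ x₃ ≡ ½ * ΣVⁿ 5 (summand ∘ lookup)
  wH≡ΣVⁿ = cong (½ *_) (ΣV⁵-tuple _ λ { a b c d e 0F → refl ; a b c d e 1F → refl ; a b c d e 2F → refl
                                      ; a b c d e 3F → refl ; a b c d e 4F → refl })

  weight : Pattern → Fin n → Fin n → ℚ
  weight p y z = W H (prefix v) * ψ H v X
    where v = lookup (fill H x₁ x₂ x₃ p (y ∷ z ∷ []))

  Φ : Pattern → ℚ
  Φ p = ΣV[ CN H X ] (λ y → ΣV[ CN H (X⁺ y) ] (weight p y))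

  ΣVⁿ-summand : ΣVⁿ 5 (summand ∘ lookup) ≡ sumℚ (map Φ patterns)
  ΣVⁿ-summand = begin
    ΣVⁿ 5 (summand ∘ lookup)                                  ≡⟨ ΣVⁿ-cong 5 (summand-by-patterns ∘ lookup) ⟩
    ΣVⁿ 5 (λ w → sumℚ (map (λ p → restricted p w) patterns))  ≡⟨ ΣVⁿ-comm-sumℚ 5 restricted patterns ⟩
    sumℚ (map (λ p → ΣVⁿ 5 (restricted p)) patterns)          ≡⟨ cong sumℚ (map-cong collapse patterns) ⟩
    sumℚ (map Φ patterns)                                     ∎
    where
    open ≡-Reasoning
    restricted : Pattern → Vec (Fin n) 5 → ℚ
    restricted p w = if matches H x₁ x₂ x₃ (lookup w) p then cliqueTerm (lookup w) else 0ℚ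
    collapse : ∀ p → ΣVⁿ 5 (restricted p) ≡ Φ p
    collapse p = begin
      ΣVⁿ 5 (restricted p)
        ≡⟨ ΣVⁿ-matches H x₁ x₂ x₃ p (cliqueTerm ∘ lookup) ⟩
      ΣV (λ y → ΣV (λ z → cliqueTerm (lookup (fill H x₁ x₂ x₃ p (y ∷ z ∷ [])))))
        ≡⟨ ΣV-cong (λ y → ΣV-cong (λ z →
             cong (λ b → if b then weight p y z else 0ℚ) (isOrdered5Clique-fill y z p))) ⟩
      ΣV (λ y → ΣV (λ z → if CN H X y ∧ CN H (X⁺ y) z then weight p y z else 0ℚ))
        ≡⟨ ΣV-nested-∧ (CN H X) (λ y → CN H (X⁺ y)) (weight p) ⟩
      Φ p
        ∎

  ΣΣ : (Fin n → Fin n → ℚ) → ℚ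
  ΣΣ g = ΣV[ CN H X ] (λ y → ΣV[ CN H (X⁺ y) ] (g y))

  Φ-with-constant-ψ : ∀ p c → (∀ {y z} → CN H X y ≡ true → CN H (X⁺ y) z ≡ true →
                      let v = lookup (fill H x₁ x₂ x₃ p (y ∷ z ∷ [])) in ψ₀ (v 0F ∈ᵇ X) (v 1F ∈ᵇ X) ≡ c) →
            Φ p ≡ ΣΣ (λ y z → W H (prefix (lookup (fill H x₁ x₂ x₃ p (y ∷ z ∷ []))))) * c
  Φ-with-constant-ψ p c ψ≡c = begin
    Φ p
      ≡⟨ ΣV[]-cong (CN H X) (λ y y∈CN → ΣV[]-cong (CN H (X⁺ y)) (λ z z∈CN →
           cong (W H (prefix (v y z)) *_) (trans (ψ-fill y z p) (ψ≡c y∈CN z∈CN)))) ⟩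
    ΣV[ CN H X ] (λ y → ΣV[ CN H (X⁺ y) ] (λ z → W H (prefix (v y z)) * c))
      ≡⟨ ΣV[]-cong (CN H X) (λ y _ → ΣV[]-*ʳ (CN H (X⁺ y)) _ c) ⟩
    ΣV[ CN H X ] (λ y → ΣV[ CN H (X⁺ y) ] (λ z → W H (prefix (v y z))) * c)
      ≡⟨ ΣV[]-*ʳ (CN H X) _ c ⟩
    ΣΣ (λ y z → W H (prefix (v y z))) * c
      ∎
    where
    open ≡-Reasoning
    v : Fin n → Fin n → Fin 5 → Fin n
    v y z = lookup (fill H x₁ x₂ x₃ p (y ∷ z ∷ []))

  A₁ A₂ : Fin n → ℚ
  A₁ y = W H (x₁ ∷ y ∷ x₂ ∷ [])
  A₂ y = W H (x₁ ∷ x₂ ∷ y ∷ [])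

  B₁ B₂ B₃ B₄ : Fin n → Fin n → ℚ
  B₁ y z = W H (x₁ ∷ y ∷ x₂ ∷ z ∷ [])
  B₂ y z = W H (x₁ ∷ x₂ ∷ y ∷ z ∷ [])
  B₃ y z = W H (x₁ ∷ y ∷ z ∷ x₂ ∷ [])
  B₄ y z = W H (y ∷ z ∷ x₁ ∷ x₂ ∷ [])

  Φ[x₁x₂x₃yz] : Φ (0F , 0F , 0F) ≡ W H (x₁ ∷ x₂ ∷ []) * ⅓
  Φ[x₁x₂x₃yz] = trans (Φ-with-constant-ψ (0F , 0F , 0F) ⅓ (λ _ _ → cong₂ ψ₀ x₁∈ᵇX x₂∈ᵇX))
    (cong (_* ⅓) (trans (ΣV[]-cong (CN H X) (λ y y∈CN → Σz-cancel y∈CN x₁ x₂ x₃ y refl)) Σy-cancel))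

  Φ[x₁x₂yx₃z] : Φ (0F , 0F , 1F) ≡ ΣV[ CN H X ] A₂ * ⅓
  Φ[x₁x₂yx₃z] = trans (Φ-with-constant-ψ (0F , 0F , 1F) ⅓ (λ _ _ → cong₂ ψ₀ x₁∈ᵇX x₂∈ᵇX))
    (cong (_* ⅓) (ΣV[]-cong (CN H X) (λ y y∈CN →
      Σz-cancel y∈CN x₁ x₂ y x₃ (setOf-↭ (prep x₁ (prep x₂ (∷↭∷ʳ y (x₃ ∷ []))))))))

  Φ[x₁x₂yzx₃] : Φ (0F , 0F , 2F) ≡ ΣΣ B₂ * ⅓
  Φ[x₁x₂yzx₃] = Φ-with-constant-ψ (0F , 0F , 2F) ⅓ (λ _ _ → cong₂ ψ₀ x₁∈ᵇX x₂∈ᵇX)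

  Φ[x₁yx₂x₃z] : Φ (0F , 1F , 1F) ≡ ΣV[ CN H X ] A₁ * -⅙
  Φ[x₁yx₂x₃z] = trans (Φ-with-constant-ψ (0F , 1F , 1F) -⅙ (λ y∈CN _ → cong₂ ψ₀ x₁∈ᵇX (y∉ᵇX y∈CN)))
    (cong (_* -⅙) (ΣV[]-cong (CN H X) (λ y y∈CN →
      Σz-cancel y∈CN x₁ y x₂ x₃ (setOf-↭ (prep x₁ (∷↭∷ʳ y (x₂ ∷ x₃ ∷ [])))))))

  Φ[x₁yx₂zx₃] : Φ (0F , 1F , 2F) ≡ ΣΣ B₁ * -⅙
  Φ[x₁yx₂zx₃] = Φ-with-constant-ψ (0F , 1F , 2F) -⅙ (λ y∈CN _ → cong₂ ψ₀ x₁∈ᵇX (y∉ᵇX y∈CN))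

  Φ[x₁yzx₂x₃] : Φ (0F , 2F , 2F) ≡ ΣΣ B₃ * -⅙
  Φ[x₁yzx₂x₃] = Φ-with-constant-ψ (0F , 2F , 2F) -⅙ (λ y∈CN _ → cong₂ ψ₀ x₁∈ᵇX (y∉ᵇX y∈CN))

  Φ[yx₁x₂x₃z] : Φ (1F , 1F , 1F) ≡ ΣV[ CN H X ] A₁ * -⅙
  Φ[yx₁x₂x₃z] = trans (Φ-with-constant-ψ (1F , 1F , 1F) -⅙ (λ y∈CN _ → cong₂ ψ₀ (y∉ᵇX y∈CN) x₁∈ᵇX))
    (cong (_* -⅙) (ΣV[]-cong (CN H X) (λ y y∈CN →
      trans (Σz-cancel y∈CN y x₁ x₂ x₃ (setOf-↭ (∷↭∷ʳ y xs))) (W-swap H y x₁ (x₂ ∷ [])))))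

  Φ[yx₁x₂zx₃] : Φ (1F , 1F , 2F) ≡ ΣΣ B₁ * -⅙
  Φ[yx₁x₂zx₃] = trans (Φ-with-constant-ψ (1F , 1F , 2F) -⅙ (λ y∈CN _ → cong₂ ψ₀ (y∉ᵇX y∈CN) x₁∈ᵇX))
    (cong (_* -⅙) (ΣV[]-cong (CN H X) (λ y _ → ΣV[]-cong (CN H (X⁺ y)) (λ z _ → W-swap H y x₁ (x₂ ∷ z ∷ [])))))

  Φ[yx₁zx₂x₃] : Φ (1F , 2F , 2F) ≡ ΣΣ B₃ * -⅙
  Φ[yx₁zx₂x₃] = trans (Φ-with-constant-ψ (1F , 2F , 2F) -⅙ (λ y∈CN _ → cong₂ ψ₀ (y∉ᵇX y∈CN) x₁∈ᵇX))
    (cong (_* -⅙) (ΣV[]-cong (CN H X) (λ y _ → ΣV[]-cong (CN H (X⁺ y)) (λ z _ → W-swap H y x₁ (z ∷ x₂ ∷ [])))))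

  Φ[yzx₁x₂x₃] : Φ (2F , 2F , 2F) ≡ ΣΣ B₄ * ⅓
  Φ[yzx₁x₂x₃] = Φ-with-constant-ψ (2F , 2F , 2F) ⅓ (λ y∈CN z∈CN → cong₂ ψ₀ (y∉ᵇX y∈CN) (z∉ᵇX y∈CN z∈CN))

  ½Σ-patterns : ½ * sumℚ (map Φ patterns) ≡
    ⅙ * (W H (x₁ ∷ x₂ ∷ []) - ((ΣV[ CN H X ] A₁ - ΣV[ CN H X ] A₂) + (((ΣΣ B₁ - ΣΣ B₂) + ΣΣ B₃) - ΣΣ B₄)))
  ½Σ-patterns = trans
    (cong (½ *_) (cong₂ _+_ Φ[x₁x₂x₃yz] (cong₂ _+_ Φ[x₁x₂yx₃z] (cong₂ _+_ Φ[x₁x₂yzx₃] (cong₂ _+_ Φ[x₁yx₂x₃z]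
      (cong₂ _+_ Φ[x₁yx₂zx₃] (cong₂ _+_ Φ[x₁yzx₂x₃] (cong₂ _+_ Φ[yx₁x₂x₃z] (cong₂ _+_ Φ[yx₁x₂zx₃]
      (cong₂ _+_ Φ[yx₁zx₂x₃] (cong₂ _+_ Φ[yzx₁x₂x₃] refl)))))))))))
    (combine (W H (x₁ ∷ x₂ ∷ [])) (ΣV[ CN H X ] A₁) (ΣV[ CN H X ] A₂) (ΣΣ B₁) (ΣΣ B₂) (ΣΣ B₃) (ΣΣ B₄))
    where
    combine : ∀ w a₁ a₂ b₁ b₂ b₃ b₄ →
      ½ * (w * ⅓ + (a₂ * ⅓ + (b₂ * ⅓ + (a₁ * -⅙ + (b₁ * -⅙ + (b₃ * -⅙
        + (a₁ * -⅙ + (b₁ * -⅙ + (b₃ * -⅙ + (b₄ * ⅓ + 0ℚ))))))))))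
      ≡ ⅙ * (w - ((a₁ - a₂) + (((b₁ - b₂) + b₃) - b₄)))
    combine = solve 7 (λ w a₁ a₂ b₁ b₂ b₃ b₄ →
      con ½ :* (w :* con ⅓ :+ (a₂ :* con ⅓ :+ (b₂ :* con ⅓ :+ (a₁ :* con -⅙ :+ (b₁ :* con -⅙ :+ (b₃ :* con -⅙
        :+ (a₁ :* con -⅙ :+ (b₁ :* con -⅙ :+ (b₃ :* con -⅙ :+ (b₄ :* con ⅓ :+ con 0ℚ))))))))))
      := con ⅙ :* (w :- ((a₁ :- a₂) :+ (((b₁ :- b₂) :+ b₃) :- b₄)))) refl

  RHS-linear :
    ΣV[ CN H X ] (λ y → (A₁ y - A₂ y) + ΣV[ CN H (X⁺ y) ] (λ z → ((B₁ y z - B₂ y z) + B₃ y z) - B₄ y z))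
    ≡ (ΣV[ CN H X ] A₁ - ΣV[ CN H X ] A₂) + (((ΣΣ B₁ - ΣΣ B₂) + ΣΣ B₃) - ΣΣ B₄)
  RHS-linear = begin
    ΣV[ CN H X ] (λ y → (A₁ y - A₂ y) + ΣV[ CN H (X⁺ y) ] (λ z → ((B₁ y z - B₂ y z) + B₃ y z) - B₄ y z))
      ≡⟨ ΣV[]-linear₂ (CN H X) A₁ A₂ _ ⟩
    (ΣV[ CN H X ] A₁ - ΣV[ CN H X ] A₂)
      + ΣV[ CN H X ] (λ y → ΣV[ CN H (X⁺ y) ] (λ z → ((B₁ y z - B₂ y z) + B₃ y z) - B₄ y z))
      ≡⟨ cong (_+_ (ΣV[ CN H X ] A₁ - ΣV[ CN H X ] A₂)) (trans
           (ΣV[]-cong (CN H X) (λ y _ → ΣV[]-linear₃ (CN H (X⁺ y)) (B₁ y) (B₂ y) (B₃ y) (B₄ y)))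
           (ΣV[]-linear₃ (CN H X) (λ y → ΣV[ CN H (X⁺ y) ] (B₁ y)) (λ y → ΣV[ CN H (X⁺ y) ] (B₂ y))
                                  (λ y → ΣV[ CN H (X⁺ y) ] (B₃ y)) (λ y → ΣV[ CN H (X⁺ y) ] (B₄ y)))) ⟩
    (ΣV[ CN H X ] A₁ - ΣV[ CN H X ] A₂) + (((ΣΣ B₁ - ΣΣ B₂) + ΣΣ B₃) - ΣΣ B₄)
      ∎
    where open ≡-Reasoning

lemma3p3 : (n : ℕ) → 5 ≤ n → (H : Hypergraph3 n)
    → (∀ (p : Subset n) → ∣ p ∣ ≡ 2 → 0 < deg H p → 5 Data.Nat.* n < 6 Data.Nat.* deg H p)
    → (x₁ x₂ x₃ : Fin n) → x₁ ≢ x₂ → x₁ ≢ x₃ → x₂ ≢ x₃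
    → E H (setOf (x₁ ∷ x₂ ∷ x₃ ∷ [])) ≡ true
    → wH H x₁ x₂ x₃ ≡
        (+ 1 / 6) * (W H (x₁ ∷ x₂ ∷ [])
          - ΣV[ CN H (setOf (x₁ ∷ x₂ ∷ x₃ ∷ [])) ] (λ y →
              (W H (x₁ ∷ y ∷ x₂ ∷ []) - W H (x₁ ∷ x₂ ∷ y ∷ []))
              + ΣV[ CN H (setOf (x₁ ∷ x₂ ∷ x₃ ∷ y ∷ [])) ] (λ z →
                  ((W H (x₁ ∷ y ∷ x₂ ∷ z ∷ []) - W H (x₁ ∷ x₂ ∷ y ∷ z ∷ []))
                   + W H (x₁ ∷ y ∷ z ∷ x₂ ∷ []))
                  - W H (y ∷ z ∷ x₁ ∷ x₂ ∷ []))))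
lemma3p3 n _ H codegree x₁ x₂ x₃ x₁≢x₂ x₁≢x₃ x₂≢x₃ edge = begin
  wH H x₁ x₂ x₃                 ≡⟨ wH≡ΣVⁿ ⟩
  ½ * ΣVⁿ 5 (summand ∘ lookup)  ≡⟨ cong (½ *_) ΣVⁿ-summand ⟩
  ½ * sumℚ (map Φ patterns)     ≡⟨ ½Σ-patterns ⟩
  ⅙ * (W H (x₁ ∷ x₂ ∷ []) - _)  ≡⟨ cong (λ t → ⅙ * (W H (x₁ ∷ x₂ ∷ []) - t)) RHS-linear ⟨
  _                             ∎
  where
  open ≡-Reasoning
  open OrderedEdge H codegree x₁ x₂ x₃ x₁≢x₂ x₁≢x₃ x₂≢x₃ edge
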